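{- Let $r\in\mathbb{N}$ and $i\in\{0,1\}$. Then, as formal power series, $$\sum_{n=0}^{\infty}\frac{D^{(i)}_r(n)}{n!}x^n=\frac12\left(\frac{x^r e^{ -x}}{(1-x)^{r+1}}+(-1)^{r+i}\frac{x^r e^{ -x}}{(1+x)^{r-1}}\right).$$
   Context: $\mathbb{N}$ denotes the non-negative integers. $D^{(i)}_r(n)$ is the number of permutations $\sigma$ of $\{1,\ldots,r+n\}$ with no fixed points, such that any two distinct elements of $\{1,\ldots,r\}$ lie in different cycles of $\sigma$, and with parity $i$ (parity $0$ = even, $1$ = odd). -}

module Defs where

open import Data.Nat as ℕ using (ℕ; zero; suc; _∸_; _<_; _<?_; _!; _%_)
open import Data.Nat.Properties using (_!≢0)
open import Data.Fin as Fin using (Fin; toℕ)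
open import Data.Fin.Properties as FinP using (all?; any?)
open import Data.Vec using (Vec; []; _∷_; lookup)
open import Data.List using (List; []; _∷_; [_]; map; concatMap; filter; length; foldr; upTo; allFin)
open import Data.Nat.ListAction using (sum)
open import Data.Product using (∃; _×_; _,_)
open import Data.Integer as ℤ using (ℤ; +_)
open import Data.Rational as ℚ using (ℚ; 0ℚ; 1ℚ; _/_; ½)
open import Relation.Nullary using (¬_; Dec; yes; no)
open import Relation.Nullary.Decidable using (_×-dec_; _→-dec_; ¬?)
open import Relation.Binary.PropositionalEquality using (_≡_; _≢_)

-- Permutations of an m-element set {0,…,m-1} (standing for {1,…,m}),
-- represented by their table of values.

Fun : ℕ → Set
Fun m = Vec (Fin m) m

iter : ∀ {m} → Fun m → ℕ → Fin m → Fin m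
iter σ zero    a = a
iter σ (suc k) a = lookup σ (iter σ k a)

-- σ is a permutation (a bijection of a finite set; injective suffices)
IsPerm : ∀ {m} → Fun m → Set
IsPerm σ = ∀ a b → lookup σ a ≡ lookup σ b → a ≡ b

Derangement : ∀ {m} → Fun m → Set
Derangement σ = ∀ a → lookup σ a ≢ a

-- a and b lie in the same cycle of σ: b = σ^k(a) for some k
-- (for a permutation of an m-element set it suffices to take k < m)
SameCycle : ∀ {m} → Fun m → Fin m → Fin m → Set
SameCycle {m} σ a b = ∃ λ (k : Fin m) → iter σ (toℕ k) a ≡ b

Separates : ∀ {m} → ℕ → Fun m → Set
Separates r σ = ∀ a b → toℕ a < r → toℕ b < r → a ≢ b → ¬ SameCycle σ a b

inversions : ∀ {m} → Fun m → ℕ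
inversions {m} σ =
  sum (map (λ a → sum (map (λ b → inv a b) (allFin m))) (allFin m))
  where
  inv : Fin m → Fin m → ℕ
  inv a b with toℕ a <? toℕ b | toℕ (lookup σ b) <? toℕ (lookup σ a)
  ... | yes _ | yes _ = 1
  ... | _     | _     = 0

HasParity : ∀ {m} → Fin 2 → Fun m → Set
HasParity i σ = inversions σ % 2 ≡ toℕ i

-- the set counted by D^{(i)}_r(n), with m = r + n
Counted : ∀ {m} → ℕ → Fin 2 → Fun m → Set
Counted r i σ = IsPerm σ × Derangement σ × Separates r σ × HasParity i σ

Counted? : ∀ {m} r i (σ : Fun m) → Dec (Counted r i σ)
Counted? {m} r i σ =
  (all? λ a → all? λ b → (lookup σ a Fin.≟ lookup σ b) →-dec (a Fin.≟ b))
  ×-dec (all? λ a → ¬? (lookup σ a Fin.≟ a))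
  ×-dec (all? λ a → all? λ b → (toℕ a <? r) →-dec (toℕ b <? r) →-dec
           ¬? (a Fin.≟ b) →-dec ¬? (any? λ k → iter σ (toℕ k) a Fin.≟ b))
  ×-dec (inversions σ % 2 ℕ.≟ toℕ i)

allVecs : ∀ m k → List (Vec (Fin m) k)
allVecs m zero    = [ [] ]
allVecs m (suc k) = concatMap (λ x → map (x ∷_) (allVecs m k)) (allFin m)

D : Fin 2 → ℕ → ℕ → ℕ
D i r n = length (filter (Counted? r i) (allVecs (r ℕ.+ n) (r ℕ.+ n)))

FPS : Set
FPS = ℕ → ℚ

_≋_ : FPS → FPS → Set
f ≋ g = ∀ n → f n ≡ g n

infixl 6 _⊕_
infixl 7 _⊛_

_⊕_ : FPS → FPS → FPS
(f ⊕ g) n = f n ℚ.+ g n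

scale : ℚ → FPS → FPS
scale c f n = c ℚ.* f n

_⊛_ : FPS → FPS → FPS
(f ⊛ g) n = foldr ℚ._+_ 0ℚ (map (λ k → f k ℚ.* g (n ∸ k)) (upTo (suc n)))

one : FPS
one zero    = 1ℚ
one (suc _) = 0ℚ

pow : FPS → ℕ → FPS
pow f zero    = one
pow f (suc k) = f ⊛ pow f k

sgn : ℕ → ℚ
sgn zero    = 1ℚ
sgn (suc k) = ℚ.- sgn k

X : FPS
X (suc zero) = 1ℚ
X _          = 0ℚ

onePlusX : FPS
onePlusX zero       = 1ℚ
onePlusX (suc zero) = 1ℚ
onePlusX _          = 0ℚ

expNeg : FPS
expNeg n = sgn n ℚ.* ((+ 1) / (n !)) {{n !≢0}}

invOneMinusX : FPS
invOneMinusX _ = 1ℚ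

invOnePlusX : FPS
invOnePlusX n = sgn n

egfD : Fin 2 → ℕ → FPS
egfD i r n = ((+ D i r n) / (n !)) {{n !≢0}}

-- right-hand side:
-- ½ ( x^r e^{-x} (1-x)^{-(r+1)} + (-1)^{r+i} x^r e^{-x} (1+x)^{-(r-1)} )
-- where (1+x)^{-(r-1)} = (1+x)^1 when r = 0 and (1/(1+x))^{r-1} when r ≥ 1.
onePlusXPow1-r : ℕ → FPS
onePlusXPow1-r zero    = onePlusX
onePlusXPow1-r (suc r) = pow invOnePlusX r

rhs : Fin 2 → ℕ → FPS
rhs i r = scale ½
  ( pow X r ⊛ expNeg ⊛ pow invOneMinusX (suc r)
  ⊕ scale (sgn (r ℕ.+ toℕ i)) (pow X r ⊛ expNeg ⊛ onePlusXPow1-r r))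

module Submission where

open import Defs
open import Data.Nat using (ℕ; _!)
open import Data.Nat.Properties using (_!≢0)
open import Data.Fin using (Fin)
import Data.Integer as ℤ
import Data.Rational as ℚ
open import Relation.Binary.PropositionalEquality using (cong; module ≡-Reasoning)

module Counting where

  open import Data.Bool using (if_then_else_)
  open import Data.Empty using (⊥; ⊥-elim)
  open import Data.Fin as Fin using (Fin; zero; suc; toℕ; fromℕ<; opposite)
  import Data.Fin.Permutation as Permutation
  import Data.Fin.Properties as Fin
  import Data.List as List
  open import Data.List using (List; []; _∷_; _++_; map; filter; length; concatMap; cartesianProductWith; allFin)
  open import Data.List.Membership.Propositional using (_∈_)
  open import Data.List.Membership.Propositional.Properties
    using (∈-lookup; ∈-++⁻; ∈-++⁺ˡ; ∈-++⁺ʳ; ∈-map⁺; ∈-map⁻; ∈-filter⁺; ∈-filter⁻; ∈-cartesianProductWith⁺; ∈-allFin)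
  open import Data.List.Properties using (length-++; length-map; map-tabulate; filter-accept; filter-reject)
  import Data.List.Relation.Unary.All as All
  open import Data.List.Relation.Unary.AllPairs using ([]; _∷_)
  open import Data.List.Relation.Unary.Any as Any using (here)
  open import Data.List.Relation.Unary.Any.Properties using (lookup-index)
  open import Data.List.Relation.Unary.Unique.Propositional using (Unique)
  import Data.List.Relation.Unary.Unique.Propositional.Properties as Unique
  open import Data.Nat as ℕ using (ℕ; zero; suc; _+_; _*_; _∸_; _≤_; _<_; s≤s; NonZero)
  import Data.Nat.Properties as ℕ
  open import Algebra.Properties.Semiring.Sum ℕ.+-*-semiring
    using (sum; sum-cong-≗; ∑-distrib-+; ∑-comm; ∑-permute; *-distribˡ-sum; sum-replicate-zero)
  open import Data.Nat.DivMod using (_%_; _/_; m≡m%n+[m/n]*n; m%n<n; [m+kn]%n≡m%n)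
  open import Data.Nat.ListAction using () renaming (sum to listSum)
  open import Data.Nat.Solver using (module +-*-Solver)
  open import Data.Product using (Σ; ∃; _×_; _,_; proj₁; proj₂; uncurry)
  open import Data.Sum using (_⊎_; inj₁; inj₂; [_,_]; reduce)
  open import Data.Sum.Properties using (inj₁-injective; inj₂-injective)
  open import Data.Product.Properties using (,-injectiveʳ)
  open import Data.Vec as Vec using (Vec; []; _∷_; lookup; tabulate)
  open import Data.Vec.Functional using (updateAt)
  open import Data.Vec.Functional.Properties using (updateAt-updates; updateAt-minimal)
  open import Data.Vec.Properties using (lookup∘tabulate; tabulate∘lookup; tabulate-cong; ∷-injective)
  open import Function using (_∘_; id; case_of_)
  open import Relation.Binary using (tri<; tri≈; tri>)
  open import Relation.Binary.PropositionalEquality using (_≡_; _≢_; refl; sym; trans; cong; cong₂; subst; module ≡-Reasoning)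
  open import Relation.Nullary using (¬_; Dec; does; yes; no)
  open import Relation.Nullary.Decidable using (_×-dec_; _→-dec_; ¬?; map′)
  open import Relation.Unary using (Pred; Decidable)
  open import Level using (0ℓ)

  lookup-injective : ∀ {A : Set} {xs : List A} → Unique xs → ∀ {i j} → List.lookup xs i ≡ List.lookup xs j → i ≡ j
  lookup-injective (_ ∷ _) {zero} {zero} _ = refl
  lookup-injective (x∉ ∷ _) {zero} {suc j} eq = ⊥-elim (All.lookup x∉ (∈-lookup j) eq)
  lookup-injective (x∉ ∷ _) {suc i} {zero} eq = ⊥-elim (All.lookup x∉ (∈-lookup i) (sym eq))
  lookup-injective (_ ∷ u) {suc i} {suc j} eq = cong suc (lookup-injective u eq)

  record Enumeration {A : Set} (P : Pred A 0ℓ) : Set where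
    field
      elements : List A
      unique : Unique elements
      sound : ∀ {x} → x ∈ elements → P x
      complete : ∀ {x} → P x → x ∈ elements

    size : ℕ
    size = length elements

  open Enumeration public

  injection⇒size≤ : ∀ {A B : Set} {P : Pred A 0ℓ} {Q : Pred B 0ℓ} (E : Enumeration P) (E′ : Enumeration Q) (f : A → B)
    → (∀ {x} → P x → Q (f x)) → (∀ {x y} → P x → P y → f x ≡ f y → x ≡ y) → size E ≤ size E′
  injection⇒size≤ E E′ f f-maps f-injective = Fin.injective⇒≤ reindex-injective
    where
    reindex : Fin (size E) → Fin (size E′)
    reindex i = Any.index (complete E′ (f-maps (sound E (∈-lookup i))))

    image : ∀ i → f (List.lookup (elements E) i) ≡ List.lookup (elements E′) (reindex i)
    image i = lookup-index (complete E′ _)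

    reindex-injective : ∀ {i j} → reindex i ≡ reindex j → i ≡ j
    reindex-injective {i} {j} eq = lookup-injective (unique E)
      (f-injective (sound E (∈-lookup i)) (sound E (∈-lookup j))
        (trans (image i) (trans (cong (List.lookup (elements E′)) eq) (sym (image j)))))

  bijection⇒size≡ : ∀ {A B : Set} {P : Pred A 0ℓ} {Q : Pred B 0ℓ} (E : Enumeration P) (E′ : Enumeration Q) (f : A → B) (g : B → A)
    → (∀ {x} → P x → Q (f x)) → (∀ {y} → Q y → P (g y))
    → (∀ {x} → P x → g (f x) ≡ x) → (∀ {y} → Q y → f (g y) ≡ y)
    → size E ≡ size E′
  bijection⇒size≡ E E′ f g f-maps g-maps gf fg = ℕ.≤-antisym
    (injection⇒size≤ E E′ f f-maps (λ px py eq → trans (sym (gf px)) (trans (cong g eq) (gf py))))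
    (injection⇒size≤ E′ E g g-maps (λ qx qy eq → trans (sym (fg qx)) (trans (cong f eq) (fg qy))))

  filter-enumeration : ∀ {A : Set} {P : Pred A 0ℓ} (P? : Decidable P) (xs : List A) → Unique xs → (∀ x → x ∈ xs) → Enumeration P
  filter-enumeration P? xs xs-unique xs-complete = record
    { elements = filter P? xs
    ; unique = Unique.filter⁺ P? xs-unique
    ; sound = λ x∈ → proj₂ (∈-filter⁻ P? {xs = xs} x∈)
    ; complete = λ {x} px → ∈-filter⁺ P? (xs-complete x) px
    }

  size-empty : ∀ {A : Set} {P : Pred A 0ℓ} → (E : Enumeration P) → (∀ {x} → ¬ P x) → size E ≡ 0
  size-empty E ¬P with elements E | sound E
  ... | []    | _     = refl
  ... | _ ∷ _ | sound = ⊥-elim (¬P (sound (here refl)))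

  empty-enumeration : ∀ {A : Set} {P : Pred A 0ℓ} → (∀ {x} → ¬ P x) → Enumeration P
  empty-enumeration ¬P = record { elements = [] ; unique = [] ; sound = λ () ; complete = λ px → ⊥-elim (¬P px) }

  module Union {A B C : Set} {P : Pred A 0ℓ} {Q : Pred B 0ℓ} {R : Pred C 0ℓ}
    (E : Enumeration P) (E′ : Enumeration Q) (f : A → C) (g : B → C)
    (f-injective : ∀ {x y} → f x ≡ f y → x ≡ y) (g-injective : ∀ {x y} → g x ≡ g y → x ≡ y) (f≢g : ∀ {x y} → f x ≢ g y)
    (f-maps : ∀ {x} → P x → R (f x)) (g-maps : ∀ {y} → Q y → R (g y))
    (covers : ∀ {z} → R z → (Σ A λ x → P x × f x ≡ z) ⊎ (Σ B λ y → Q y × g y ≡ z))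
    where

    union-enumeration : Enumeration R
    union-enumeration = record
      { elements = map f (elements E) ++ map g (elements E′)
      ; unique = Unique.++⁺ (Unique.map⁺ f-injective (unique E)) (Unique.map⁺ g-injective (unique E′)) disjoint
      ; sound = sound′
      ; complete = complete′
      }
      where
      disjoint : ∀ {z} → ¬ (z ∈ map f (elements E) × z ∈ map g (elements E′))
      disjoint (z∈f , z∈g) with ∈-map⁻ f z∈f | ∈-map⁻ g z∈g
      ... | _ , _ , refl | _ , _ , eq = f≢g eq
      sound′ : ∀ {z} → z ∈ map f (elements E) ++ map g (elements E′) → R z
      sound′ z∈ with ∈-++⁻ (map f (elements E)) z∈
      ... | inj₁ z∈f with ∈-map⁻ f z∈f
      ...   | _ , x∈ , refl = f-maps (sound E x∈)
      sound′ z∈ | inj₂ z∈g with ∈-map⁻ g z∈g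
      ...   | _ , y∈ , refl = g-maps (sound E′ y∈)
      complete′ : ∀ {z} → R z → z ∈ map f (elements E) ++ map g (elements E′)
      complete′ rz with covers rz
      ... | inj₁ (x , px , refl) = ∈-++⁺ˡ (∈-map⁺ f (complete E px))
      ... | inj₂ (y , qy , refl) = ∈-++⁺ʳ (map f (elements E)) (∈-map⁺ g (complete E′ qy))

    size-union : size union-enumeration ≡ size E + size E′
    size-union = trans (length-++ (map f (elements E))) (cong₂ _+_ (length-map f (elements E)) (length-map g (elements E′)))

  module _ {A B : Set} {P : Pred A 0ℓ} {Q : Pred B 0ℓ} where

    private
      inj₁≢inj₂ : ∀ {x : A} {y : B} → inj₁ x ≢ inj₂ y
      inj₁≢inj₂ ()

      ⊎-covers : ∀ {z} → [ P , Q ] z → (Σ A λ x → P x × inj₁ x ≡ z) ⊎ (Σ B λ y → Q y × inj₂ y ≡ z)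
      ⊎-covers {inj₁ x} px = inj₁ (x , px , refl)
      ⊎-covers {inj₂ y} qy = inj₂ (y , qy , refl)

    ⊎-enumeration : Enumeration P → Enumeration Q → Enumeration [ P , Q ]
    ⊎-enumeration E E′ = Union.union-enumeration E E′ inj₁ inj₂ inj₁-injective inj₂-injective inj₁≢inj₂ id id ⊎-covers

    size-⊎ : (E : Enumeration P) (E′ : Enumeration Q) → size (⊎-enumeration E E′) ≡ size E + size E′
    size-⊎ E E′ = Union.size-union E E′ inj₁ inj₂ inj₁-injective inj₂-injective inj₁≢inj₂ id id ⊎-covers

  module _ {n} {C : Set} {Q : Fin (ℕ.suc n) → Pred C 0ℓ} where

    private
      shiftIndex : Fin n × C → Fin (ℕ.suc n) × C
      shiftIndex (a , c) = suc a , c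

      shiftIndex-injective : ∀ {x y} → shiftIndex x ≡ shiftIndex y → x ≡ y
      shiftIndex-injective {_ , _} {_ , _} refl = refl

      zero≢shiftIndex : ∀ {c y} → (zero , c) ≢ shiftIndex y
      zero≢shiftIndex {y = _ , _} ()

      Σ-covers : ∀ {z} → uncurry Q z → (Σ C λ c → Q zero c × (zero , c) ≡ z) ⊎ (Σ (Fin n × C) λ y → uncurry (Q ∘ suc) y × shiftIndex y ≡ z)
      Σ-covers {zero , c} q = inj₁ (c , q , refl)
      Σ-covers {suc a , c} q = inj₂ ((a , c) , q , refl)

    Σ-step : Enumeration (Q zero) → Enumeration (uncurry (Q ∘ suc)) → Enumeration (uncurry Q)
    Σ-step E₀ E₊ = Union.union-enumeration E₀ E₊ (zero ,_) shiftIndex ,-injectiveʳ shiftIndex-injective zero≢shiftIndex id id Σ-covers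

    size-Σ-step : (E₀ : Enumeration (Q zero)) (E₊ : Enumeration (uncurry (Q ∘ suc))) → size (Σ-step E₀ E₊) ≡ size E₀ + size E₊
    size-Σ-step E₀ E₊ = Union.size-union E₀ E₊ (zero ,_) shiftIndex ,-injectiveʳ shiftIndex-injective zero≢shiftIndex id id Σ-covers

  Σ-enumeration : ∀ {n} {C : Set} {Q : Fin n → Pred C 0ℓ} → (∀ a → Enumeration (Q a)) → Enumeration (uncurry Q)
  Σ-enumeration {ℕ.zero} E = empty-enumeration λ { {() , _} }
  Σ-enumeration {ℕ.suc n} E = Σ-step (E zero) (Σ-enumeration (E ∘ suc))

  size-Σ : ∀ {n} {C : Set} {Q : Fin n → Pred C 0ℓ} (E : ∀ a → Enumeration (Q a)) → size (Σ-enumeration E) ≡ sum (λ a → size (E a))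
  size-Σ {ℕ.zero} E = refl
  size-Σ {ℕ.suc n} {Q = Q} E = trans (size-Σ-step {Q = Q} (E zero) (Σ-enumeration (E ∘ suc))) (cong (size (E zero) +_) (size-Σ (E ∘ suc)))

  guard-enumeration : ∀ {A C : Set} {P : Pred A 0ℓ} → Dec C → Enumeration P → Enumeration (λ x → C × P x)
  guard-enumeration (yes c) E = record
    { elements = elements E ; unique = unique E ; sound = λ x∈ → c , sound E x∈ ; complete = λ (_ , px) → complete E px }
  guard-enumeration (no ¬c) E = empty-enumeration (λ (c , _) → ¬c c)

  𝟙[_] : ∀ {P : Set} → Dec P → ℕ
  𝟙[ d ] = if does d then 1 else 0

  𝟙-yes : ∀ {P : Set} → P → (d : Dec P) → 𝟙[ d ] ≡ 1
  𝟙-yes _ (yes _) = refl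
  𝟙-yes p (no ¬p) = ⊥-elim (¬p p)

  𝟙-no : ∀ {P : Set} → ¬ P → (d : Dec P) → 𝟙[ d ] ≡ 0
  𝟙-no ¬p (yes p) = ⊥-elim (¬p p)
  𝟙-no _ (no _) = refl

  [_<_] : ℕ → ℕ → ℕ
  [ x < y ] = 𝟙[ x ℕ.<? y ]

  [<]-irrefl : ∀ x → [ x < x ] ≡ 0
  [<]-irrefl x = 𝟙-no (ℕ.<-irrefl refl) (x ℕ.<? x)

  [<]-connex : ∀ {x y} → x ≢ y → [ x < y ] + [ y < x ] ≡ 1
  [<]-connex {x} {y} x≢y with ℕ.<-cmp x y
  ... | tri< x<y _ y≮x = cong₂ _+_ (𝟙-yes x<y (x ℕ.<? y)) (𝟙-no y≮x (y ℕ.<? x))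
  ... | tri≈ _ x≡y _ = ⊥-elim (x≢y x≡y)
  ... | tri> x≮y _ y<x = cong₂ _+_ (𝟙-no x≮y (x ℕ.<? y)) (𝟙-yes y<x (y ℕ.<? x))

  ∑-pick : ∀ {n} (a : Fin n) (F : Fin n → ℕ) → sum (λ x → 𝟙[ x Fin.≟ a ] * F x) ≡ F a
  ∑-pick {suc n} zero F = trans (cong (F zero + 0 +_) (sum-replicate-zero n)) (trans (ℕ.+-identityʳ _) (ℕ.+-identityʳ _))
  ∑-pick {suc n} (suc a) F = trans (sum-cong-≗ {n} {y = λ x → 𝟙[ x Fin.≟ a ] * F (suc x)} shift) (∑-pick a (F ∘ suc))
    where
    shift : ∀ x → 𝟙[ suc x Fin.≟ suc a ] * F (suc x) ≡ 𝟙[ x Fin.≟ a ] * F (suc x)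
    shift x with x Fin.≟ a
    ... | yes _ = refl
    ... | no _ = refl

  ∑-below : ∀ {n} k → k ≤ n → sum {n} (λ y → [ toℕ y < k ]) ≡ k
  ∑-below {n} zero _ = trans (sum-cong-≗ {n} (λ y → 𝟙-no (λ ()) (toℕ y ℕ.<? 0))) (sum-replicate-zero n)
  ∑-below {suc n} (suc k) (s≤s k≤n) = cong suc (∑-below k k≤n)

  Injective : ∀ {n} → (Fin n → Fin n) → Set
  Injective π = ∀ {x y} → π x ≡ π y → x ≡ y

  injective⇒surjective : ∀ {n} {π : Fin n → Fin n} → Injective π → ∀ y → ∃ λ x → π x ≡ y
  injective⇒surjective {suc n} {π} π-injective y with Fin.any? (λ x → π x Fin.≟ y)
  ... | yes hit = hit
  ... | no miss = ⊥-elim (ℕ.<-irrefl refl (Fin.injective⇒≤ punched-injective))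
    where
    -- without y in its image, π would inject Fin (suc n) into Fin n
    π≢y : ∀ x → y ≢ π x
    π≢y x eq = miss (x , sym eq)
    punched-injective : ∀ {x x′} → Fin.punchOut (π≢y x) ≡ Fin.punchOut (π≢y x′) → x ≡ x′
    punched-injective eq = π-injective (Fin.punchOut-injective (π≢y _) (π≢y _) eq)

  injective⇒permutation : ∀ {n} {π : Fin n → Fin n} → Injective π → Permutation.Permutation n n
  injective⇒permutation {π = π} π-injective = Permutation.permutation π (proj₁ ∘ surj) (proj₂ ∘ surj)
    (λ x → π-injective (proj₂ (surj (π x))))
    where surj = injective⇒surjective π-injective

  ∑-reindex : ∀ {n} {π : Fin n → Fin n} → Injective π → (f : Fin n → ℕ) → sum (f ∘ π) ≡ sum f
  ∑-reindex π-injective f = sym (∑-permute f (injective⇒permutation π-injective))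

  ∑-below-injective : ∀ {n} {π : Fin n → Fin n} → Injective π → ∀ k → k ≤ n → sum (λ y → [ toℕ (π y) < k ]) ≡ k
  ∑-below-injective π-injective k k≤n = trans (∑-reindex π-injective (λ y → [ toℕ y < k ])) (∑-below k k≤n)

  ∑-indicator : ∀ {n} (a : Fin n) → sum (λ x → 𝟙[ x Fin.≟ a ]) ≡ 1
  ∑-indicator {n} a = trans (sum-cong-≗ {n} λ x → sym (ℕ.*-identityʳ _)) (∑-pick a (λ _ → 1))

  ∑-one : ∀ n → sum {n} (λ _ → 1) ≡ n
  ∑-one zero = refl
  ∑-one (suc n) = cong suc (∑-one n)

  inversionCount : ∀ {m} → (Fin m → ℕ) → ℕ
  inversionCount g = sum λ x → sum λ y → [ toℕ x < toℕ y ] * [ g y < g x ]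

  inversionCount-cong : ∀ {m} {g g′ : Fin m → ℕ} → (∀ x → g x ≡ g′ x) → inversionCount g ≡ inversionCount g′
  inversionCount-cong eq = sum-cong-≗ λ x → sum-cong-≗ λ y → cong₂ (λ u v → [ toℕ x < toℕ y ] * [ u < v ]) (eq y) (eq x)

  private
    sum-allFin : ∀ {m} (f : Fin m → ℕ) → listSum (map f (allFin m)) ≡ sum f
    sum-allFin {m} f = trans (cong listSum (map-tabulate id f)) (sum-tabulate f)
      where
      sum-tabulate : ∀ {n} (f : Fin n → ℕ) → listSum (List.tabulate f) ≡ sum f
      sum-tabulate {zero} f = refl
      sum-tabulate {suc n} f = cong (f zero +_) (sum-tabulate (f ∘ suc))

    -- the summand of `inversions` is local to its definition; unification recovers it
    inversionEntry : ∀ {m} → Fun m → Fin m → Fin m → ℕ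
    inversions-unfold : ∀ {m} (σ : Fun m)
      → inversions σ ≡ listSum (map (λ a → listSum (map (inversionEntry σ a) (allFin m))) (allFin m))
    inversionEntry = _
    inversions-unfold σ = refl

    inversionEntry≡ : ∀ {m} (σ : Fun m) a b
      → inversionEntry σ a b ≡ [ toℕ a < toℕ b ] * [ toℕ (lookup σ b) < toℕ (lookup σ a) ]
    inversionEntry≡ σ a b with toℕ a ℕ.<? toℕ b | toℕ (lookup σ b) ℕ.<? toℕ (lookup σ a)
    ... | yes a<b | yes σb<σa = sym (cong₂ _*_ (𝟙-yes a<b (toℕ a ℕ.<? toℕ b)) (𝟙-yes σb<σa (toℕ (lookup σ b) ℕ.<? _)))
    ... | yes a<b | no σb≮σa = sym (cong₂ _*_ (𝟙-yes a<b (toℕ a ℕ.<? toℕ b)) (𝟙-no σb≮σa (toℕ (lookup σ b) ℕ.<? _)))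
    ... | no a≮b | _ = sym (cong (_* [ toℕ (lookup σ b) < toℕ (lookup σ a) ]) (𝟙-no a≮b (toℕ a ℕ.<? toℕ b)))

  inversions≡inversionCount : ∀ {m} (σ : Fun m) → inversions σ ≡ inversionCount (toℕ ∘ lookup σ)
  inversions≡inversionCount σ = trans (inversions-unfold σ)
    (trans (sum-allFin (λ a → listSum (map (inversionEntry σ a) (allFin _))))
      (sum-cong-≗ λ a → trans (sum-allFin (inversionEntry σ a)) (sum-cong-≗ (inversionEntry≡ σ a))))

  inversionCount-suc : ∀ {m} (g : Fin (suc m) → ℕ)
    → inversionCount g ≡ sum (λ y → [ g (suc y) < g zero ]) + inversionCount (g ∘ suc)
  inversionCount-suc {m} g = cong (_+ inversionCount (g ∘ suc)) (sum-cong-≗ {m} λ y → ℕ.+-identityʳ _)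

  inversionCount-fixed-zero : ∀ {m} (g : Fin (suc m)  → ℕ) (h : Fin m → ℕ)
    → g zero ≡ 0 → (∀ y → g (suc y) ≡ suc (h y)) → inversionCount g ≡ inversionCount h
  inversionCount-fixed-zero {m} g h g-zero g-suc = begin
    inversionCount g                                                      ≡⟨ inversionCount-suc g ⟩
    sum (λ y → [ g (suc y) < g zero ]) + inversionCount (g ∘ suc)         ≡⟨ cong₂ _+_ first-row (inversionCount-cong g-suc) ⟩
    0 + inversionCount (suc ∘ h)                                          ≡⟨⟩
    inversionCount h                                                      ∎
    where
    open ≡-Reasoning
    first-row : sum (λ y → [ g (suc y) < g zero ]) ≡ 0
    first-row = trans (sum-cong-≗ {m} λ y → trans (cong₂ [_<_] (g-suc y) g-zero) (𝟙-no (λ ()) (suc (h y) ℕ.<? 0))) (sum-replicate-zero m)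

  -- g is h with 0 moved in at position a and the old value 1 + h a moved to the front: only
  -- pairs through position a or through the front change, and they contribute 1 + 2 · smallerLeft
  module Splice {m} (g : Fin (suc m) → ℕ) (h : Fin m → ℕ) (a : Fin m)
    (g-zero : g zero ≡ suc (h a)) (g-a : g (suc a) ≡ 0) (g-other : ∀ y → y ≢ a → g (suc y) ≡ suc (h y))
    (h-injective : ∀ {x} → h x ≡ h a → x ≡ a) (h-rank : sum (λ y → [ h y < h a ]) ≡ h a)
    where

    private
      δ : Fin m → ℕ
      δ x = 𝟙[ x Fin.≟ a ]

      [_<ᶠ_] : Fin m → Fin m → ℕ
      [ x <ᶠ y ] = [ toℕ x < toℕ y ]

    smallerLeft : ℕ
    smallerLeft = sum λ x → [ toℕ x < toℕ a ] * [ h x < h a ]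

    private
      largerLeft smallerRight : ℕ
      largerLeft = sum λ x → [ x <ᶠ a ] * [ h a < h x ]
      smallerRight = sum λ y → [ a <ᶠ y ] * [ h y < h a ]

      first-row : sum (λ y → [ g (suc y) < g zero ]) ≡ suc (h a)
      first-row = trans (sum-cong-≗ entry) (trans (∑-distrib-+ δ (λ y → [ h y < h a ])) (cong₂ _+_ (∑-indicator a) h-rank))
        where
        entry : ∀ y → [ g (suc y) < g zero ] ≡ δ y + [ h y < h a ]
        entry y with y Fin.≟ a
        ... | yes refl = trans (cong₂ [_<_] g-a g-zero) (cong suc (sym ([<]-irrefl (h a))))
        ... | no y≢a = cong₂ [_<_] (g-other y y≢a) g-zero

      pair : ∀ x y → [ x <ᶠ y ] * [ g (suc y) < g (suc x) ]
                     + (δ y * ([ x <ᶠ y ] * [ h a < h x ]) + δ x * ([ x <ᶠ y ] * [ h y < h a ]))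
                   ≡ [ x <ᶠ y ] * [ h y < h x ] + δ y * [ x <ᶠ y ]
      pair x y with x Fin.≟ a | y Fin.≟ a
      ... | yes refl | yes refl rewrite [<]-irrefl (toℕ a) = refl
      ... | yes refl | no y≢a rewrite g-a | ℕ.*-zeroʳ [ a <ᶠ y ] = refl
      ... | no x≢a | yes refl rewrite g-a | g-other x x≢a =
        solve 2 (λ u v → u :* con 1 :+ ((v :+ con 0) :+ con 0) := v :+ (u :+ con 0)) refl [ x <ᶠ a ] ([ x <ᶠ a ] * [ h a < h x ])
        where open +-*-Solver
      ... | no x≢a | no y≢a rewrite g-other x x≢a | g-other y y≢a = refl

      tail-inversions : inversionCount (g ∘ suc) + (largerLeft + smallerRight) ≡ inversionCount h + toℕ a
      tail-inversions = begin
        inversionCount (g ∘ suc) + (largerLeft + smallerRight)  ≡⟨ sym split-left ⟩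
        sum (λ x → sum (λ y → T x y + (A x y + B x y)))         ≡⟨ sum-cong-≗ (λ x → sum-cong-≗ (pair x)) ⟩
        sum (λ x → sum (λ y → I x y + δ y * [ x <ᶠ y ]))         ≡⟨ split-right ⟩
        inversionCount h + toℕ a                                ∎
        where
        open ≡-Reasoning
        T A B I : Fin m → Fin m → ℕ
        T x y = [ x <ᶠ y ] * [ g (suc y) < g (suc x) ]
        A x y = δ y * ([ x <ᶠ y ] * [ h a < h x ])
        B x y = δ x * ([ x <ᶠ y ] * [ h y < h a ])
        I x y = [ x <ᶠ y ] * [ h y < h x ]

        row : ∀ x → sum (λ y → T x y + (A x y + B x y))
                  ≡ sum (T x) + ([ x <ᶠ a ] * [ h a < h x ] + δ x * sum (λ y → [ x <ᶠ y ] * [ h y < h a ]))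
        row x = trans (∑-distrib-+ (T x) (λ y → A x y + B x y)) (cong (sum (T x) +_)
          (trans (∑-distrib-+ (A x) (B x)) (cong₂ _+_ (∑-pick a (λ y → [ x <ᶠ y ] * [ h a < h x ]))
            (sym (*-distribˡ-sum (δ x) (λ y → [ x <ᶠ y ] * [ h y < h a ]))))))

        split-left : sum (λ x → sum (λ y → T x y + (A x y + B x y))) ≡ inversionCount (g ∘ suc) + (largerLeft + smallerRight)
        split-left = trans (sum-cong-≗ row) (trans (∑-distrib-+ (λ x → sum (T x)) _) (cong (inversionCount (g ∘ suc) +_)
          (trans (∑-distrib-+ (λ x → [ x <ᶠ a ] * [ h a < h x ]) _) (cong (largerLeft +_)
            (∑-pick a (λ x → sum (λ y → [ x <ᶠ y ] * [ h y < h a ])))))))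

        split-right : sum (λ x → sum (λ y → I x y + δ y * [ x <ᶠ y ])) ≡ inversionCount h + toℕ a
        split-right = trans
          (sum-cong-≗ λ x → trans (∑-distrib-+ (I x) (λ y → δ y * [ x <ᶠ y ])) (cong (sum (I x) +_) (∑-pick a (λ y → [ x <ᶠ y ]))))
          (trans (∑-distrib-+ (λ x → sum (I x)) (λ x → [ x <ᶠ a ])) (cong (inversionCount h +_) (∑-below (toℕ a) (ℕ.<⇒≤ (Fin.toℕ<n a)))))

      left-split : largerLeft + smallerLeft ≡ toℕ a
      left-split = trans (sym (∑-distrib-+ (λ x → [ x <ᶠ a ] * [ h a < h x ]) (λ x → [ x <ᶠ a ] * [ h x < h a ])))
        (trans (sum-cong-≗ entry) (∑-below (toℕ a) (ℕ.<⇒≤ (Fin.toℕ<n a))))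
        where
        entry : ∀ x → [ x <ᶠ a ] * [ h a < h x ] + [ x <ᶠ a ] * [ h x < h a ] ≡ [ x <ᶠ a ]
        entry x with x Fin.≟ a
        ... | yes refl rewrite [<]-irrefl (toℕ a) = refl
        ... | no x≢a = trans (sym (ℕ.*-distribˡ-+ [ x <ᶠ a ] _ _))
          (trans (cong ([ x <ᶠ a ] *_) ([<]-connex (x≢a ∘ h-injective ∘ sym))) (ℕ.*-identityʳ _))

      rank-split : smallerLeft + smallerRight ≡ h a
      rank-split = trans (sym (∑-distrib-+ (λ x → [ x <ᶠ a ] * [ h x < h a ]) (λ x → [ a <ᶠ x ] * [ h x < h a ])))
        (trans (sum-cong-≗ entry) h-rank)
        where
        entry : ∀ x → [ x <ᶠ a ] * [ h x < h a ] + [ a <ᶠ x ] * [ h x < h a ] ≡ [ h x < h a ]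
        entry x with x Fin.≟ a
        ... | yes refl rewrite [<]-irrefl (h a) | [<]-irrefl (toℕ a) = refl
        ... | no x≢a = trans (sym (ℕ.*-distribʳ-+ [ h x < h a ] [ x <ᶠ a ] _))
          (trans (cong (_* [ h x < h a ]) ([<]-connex (x≢a ∘ Fin.toℕ-injective))) (ℕ.*-identityˡ _))

    inversionCount-splice : inversionCount g ≡ suc (inversionCount h + 2 * smallerLeft)
    inversionCount-splice = ℕ.+-cancelʳ-≡ (largerLeft + smallerRight) _ _ (begin
      inversionCount g + (largerLeft + smallerRight)
        ≡⟨ cong (_+ (largerLeft + smallerRight)) (trans (inversionCount-suc g) (cong (_+ inversionCount (g ∘ suc)) first-row)) ⟩
      suc (h a) + inversionCount (g ∘ suc) + (largerLeft + smallerRight)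
        ≡⟨ ℕ.+-assoc (suc (h a)) _ _ ⟩
      suc (h a) + (inversionCount (g ∘ suc) + (largerLeft + smallerRight))
        ≡⟨ cong₂ (λ u v → suc u + v) (sym rank-split) tail-inversions ⟩
      suc (smallerLeft + smallerRight) + (inversionCount h + toℕ a)
        ≡⟨ cong (λ u → suc (smallerLeft + smallerRight) + (inversionCount h + u)) (sym left-split) ⟩
      suc (smallerLeft + smallerRight) + (inversionCount h + (largerLeft + smallerLeft))
        ≡⟨ solve 4 (λ sl sr ll i → con 1 :+ (sl :+ sr) :+ (i :+ (ll :+ sl)) := con 1 :+ (i :+ con 2 :* sl) :+ (ll :+ sr))
             refl smallerLeft smallerRight largerLeft (inversionCount h) ⟩
      suc (inversionCount h + 2 * smallerLeft) + (largerLeft + smallerRight) ∎)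
      where
      open ≡-Reasoning
      open +-*-Solver

  [<]-opposite : ∀ {m} (x y : Fin m) → [ toℕ (Fin.opposite x) < toℕ (Fin.opposite y) ] ≡ [ toℕ y < toℕ x ]
  [<]-opposite {m} x y =
    trans (cong₂ [_<_] (Fin.opposite-prop x) (Fin.opposite-prop y)) (reverse (toℕ x) (toℕ y) (Fin.toℕ<n x))
    where
    reverse : ∀ i j → i < m → [ m ℕ.∸ suc i < m ℕ.∸ suc j ] ≡ [ j < i ]
    reverse i j i<m with j ℕ.<? i
    ... | yes j<i = trans (𝟙-yes (ℕ.∸-monoʳ-< (ℕ.s≤s j<i) i<m) (m ℕ.∸ suc i ℕ.<? m ℕ.∸ suc j))
                          (sym (𝟙-yes j<i (j ℕ.<? i)))
    ... | no j≮i = trans (𝟙-no (ℕ.≤⇒≯ (ℕ.∸-monoʳ-≤ m (ℕ.s≤s (ℕ.≮⇒≥ j≮i)))) (m ℕ.∸ suc i ℕ.<? m ℕ.∸ suc j))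
                         (sym (𝟙-no j≮i (j ℕ.<? i)))

  opposite-injective : ∀ {m} → Injective (Fin.opposite {m})
  opposite-injective {x = x} {y} eq = trans (sym (Fin.opposite-involutive x)) (trans (cong Fin.opposite eq) (Fin.opposite-involutive y))

  inversionCount-opposite : ∀ {m} (f : Fin m → Fin m)
    → inversionCount (toℕ ∘ Fin.opposite ∘ f ∘ Fin.opposite) ≡ inversionCount (toℕ ∘ f)
  inversionCount-opposite {m} f = begin
    inversionCount (toℕ ∘ Fin.opposite ∘ f ∘ Fin.opposite)
      ≡⟨ sum-cong-≗ (λ x → sum-cong-≗ (λ y → cong₂ _*_ (reverse-positions x y) ([<]-opposite (f (ō y)) (f (ō x))))) ⟩
    sum (λ x → sum (λ y → T (ō y) (ō x)))
      ≡⟨ ∑-reindex opposite-injective (λ x → sum (λ y → T (ō y) x)) ⟩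
    sum (λ x → sum (λ y → T (ō y) x))
      ≡⟨ sum-cong-≗ (λ x → ∑-reindex opposite-injective (λ y → T y x)) ⟩
    sum (λ x → sum (λ y → T y x))
      ≡⟨ ∑-comm (λ y x → T x y) ⟩
    inversionCount (toℕ ∘ f) ∎
    where
    open ≡-Reasoning
    ō = Fin.opposite
    T : Fin m → Fin m → ℕ
    T x y = [ toℕ x < toℕ y ] * [ toℕ (f y) < toℕ (f x) ]
    reverse-positions : ∀ x y → [ toℕ x < toℕ y ] ≡ [ toℕ (ō y) < toℕ (ō x) ]
    reverse-positions x y = trans (cong₂ (λ u v → [ toℕ u < toℕ v ]) (sym (Fin.opposite-involutive x)) (sym (Fin.opposite-involutive y)))
      ([<]-opposite (ō x) (ō y))

  iterate : ∀ {m} → (Fin m → Fin m) → ℕ → Fin m → Fin m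
  iterate f zero a = a
  iterate f (suc k) a = f (iterate f k a)

  Reachable : ∀ {m} → (Fin m → Fin m) → Fin m → Fin m → Set
  Reachable f a b = ∃ λ k → iterate f k a ≡ b

  iter≡iterate : ∀ {m} (σ : Fun m) k a → iter σ k a ≡ iterate (lookup σ) k a
  iter≡iterate σ zero a = refl
  iter≡iterate σ (suc k) a = cong (lookup σ) (iter≡iterate σ k a)

  iterate-cong : ∀ {m} {f g : Fin m → Fin m} → (∀ x → f x ≡ g x) → ∀ k a → iterate f k a ≡ iterate g k a
  iterate-cong eq zero a = refl
  iterate-cong {f = f} eq (suc k) a = trans (cong f (iterate-cong eq k a)) (eq _)

  iterate-+ : ∀ {m} (f : Fin m → Fin m) j k a → iterate f (j + k) a ≡ iterate f j (iterate f k a)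
  iterate-+ f zero k a = refl
  iterate-+ f (suc j) k a = cong f (iterate-+ f j k a)

  iterate-suc : ∀ {m} (f : Fin m → Fin m) k a → iterate f (suc k) a ≡ iterate f k (f a)
  iterate-suc f zero a = refl
  iterate-suc f (suc k) a = cong f (iterate-suc f k a)

  iterate-fixed : ∀ {m} {f : Fin m → Fin m} {a} → f a ≡ a → ∀ k → iterate f k a ≡ a
  iterate-fixed fa≡a zero = refl
  iterate-fixed {f = f} fa≡a (suc k) = trans (cong f (iterate-fixed fa≡a k)) fa≡a

  iterate-injective : ∀ {m} {f : Fin m → Fin m} → Injective f → ∀ k {x y} → iterate f k x ≡ iterate f k y → x ≡ y
  iterate-injective f-inj zero eq = eq
  iterate-injective f-inj (suc k) eq = iterate-injective f-inj k (f-inj eq)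

  reaches-fixed : ∀ {m} {f : Fin m → Fin m} → Injective f → ∀ {a} → f a ≡ a → ∀ k x → iterate f k x ≡ a → x ≡ a
  reaches-fixed f-inj fa≡a zero x eq = eq
  reaches-fixed f-inj fa≡a (suc k) x eq = reaches-fixed f-inj fa≡a k x (f-inj (trans eq (sym fa≡a)))

  period : ∀ {m} {f : Fin m → Fin m} → Injective f → ∀ a → ∃ λ d → 0 < d × d ≤ m × iterate f d a ≡ a
  period {m} {f} f-inj a with Fin.pigeonhole (ℕ.n<1+n m) (λ (i : Fin (suc m)) → iterate f (toℕ i) a)
  ... | i , j , i<j , eq = toℕ j ∸ toℕ i , ℕ.m<n⇒0<n∸m i<j , d≤m , returns
    where
    d≤m : toℕ j ∸ toℕ i ≤ m
    d≤m = ℕ.≤-trans (ℕ.m∸n≤m (toℕ j) (toℕ i)) (ℕ.≤-pred (Fin.toℕ<n j))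
    returns : iterate f (toℕ j ∸ toℕ i) a ≡ a
    returns = sym (iterate-injective f-inj (toℕ i) (trans eq (trans
      (cong (λ k → iterate f k a) (sym (ℕ.m+[n∸m]≡n (ℕ.<⇒≤ i<j)))) (iterate-+ f (toℕ i) _ a))))

  iterate-period : ∀ {m} {f : Fin m → Fin m} {d a} → iterate f d a ≡ a → ∀ q → iterate f (q * d) a ≡ a
  iterate-period returns zero = refl
  iterate-period {f = f} {d} {a} returns (suc q) =
    trans (iterate-+ f d (q * d) a) (trans (cong (iterate f d) (iterate-period returns q)) returns)

  reachable⇒sameCycle : ∀ {m} (σ : Fun m) → Injective (lookup σ) → ∀ {a b} → Reachable (lookup σ) a b → SameCycle σ a b
  reachable⇒sameCycle {m} σ σ-inj {a} (k , reaches) with period σ-inj a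
  ... | d , 0<d , d≤m , returns = fromℕ< k%d<m , (begin
    iter σ (toℕ (fromℕ< k%d<m)) a            ≡⟨ cong (λ j → iter σ j a) (Fin.toℕ-fromℕ< k%d<m) ⟩
    iter σ (k % d) a                          ≡⟨ iter≡iterate σ (k % d) a ⟩
    iterate f (k % d) a                       ≡⟨ cong (iterate f (k % d)) (sym (iterate-period returns (k / d))) ⟩
    iterate f (k % d) (iterate f (k / d * d) a) ≡⟨ sym (iterate-+ f (k % d) (k / d * d) a) ⟩
    iterate f (k % d + k / d * d) a           ≡⟨ cong (λ j → iterate f j a) (sym (m≡m%n+[m/n]*n k d)) ⟩
    iterate f k a                             ≡⟨ reaches ⟩
    _                                         ∎)
    where
    open ≡-Reasoning
    f = lookup σ
    instance
      d≢0 : NonZero d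
      d≢0 = ℕ.>-nonZero 0<d
    k%d<m : k % d < m
    k%d<m = ℕ.<-≤-trans (m%n<n k d) d≤m

  sameCycle⇒reachable : ∀ {m} (σ : Fun m) {a b} → SameCycle σ a b → Reachable (lookup σ) a b
  sameCycle⇒reachable σ {a} (k , reaches) = toℕ k , trans (sym (iter≡iterate σ (toℕ k) a)) reaches

  private
    concatMap≡cartesianProduct : ∀ {m k} (xs : List (Fin m)) (ys : List (Vec (Fin m) k))
      → concatMap (λ x → map (x ∷_) ys) xs ≡ cartesianProductWith _∷_ xs ys
    concatMap≡cartesianProduct [] ys = refl
    concatMap≡cartesianProduct (x ∷ xs) ys = cong (map (x ∷_) ys List.++_) (concatMap≡cartesianProduct xs ys)

  allVecs-unique : ∀ m k → Unique (allVecs m k)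
  allVecs-unique m zero = All.[] ∷ []
  allVecs-unique m (suc k) rewrite concatMap≡cartesianProduct (allFin m) (allVecs m k) =
    Unique.cartesianProductWith⁺ _∷_ ∷-injective (Unique.allFin⁺ m) (allVecs-unique m k)

  ∈-allVecs : ∀ m k (v : Vec (Fin m) k) → v ∈ allVecs m k
  ∈-allVecs m zero [] = here refl
  ∈-allVecs m (suc k) (x ∷ v) rewrite concatMap≡cartesianProduct (allFin m) (allVecs m k) =
    ∈-cartesianProductWith⁺ _∷_ (∈-allFin x) (∈-allVecs m k v)

  -- special points are the paper's {1, …, r}; fixed points arise when 0 is deleted from a 2-cycle
  data Role : Set where
    special normal fixed : Role

  special? : (ℓ : Role) → Dec (ℓ ≡ special)
  special? special = yes refl
  special? normal = no λ ()
  special? fixed = no λ ()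

  fixed? : (ℓ : Role) → Dec (ℓ ≡ fixed)
  fixed? special = no λ ()
  fixed? normal = no λ ()
  fixed? fixed = yes refl

  Admissible : ∀ {m} → Role → Fin m → Fin m → Set
  Admissible fixed a y = y ≡ a
  Admissible special a y = y ≢ a
  Admissible normal a y = y ≢ a

  admissible? : ∀ {m} ℓ (a y : Fin m) → Dec (Admissible ℓ a y)
  admissible? fixed a y = y Fin.≟ a
  admissible? special a y = ¬? (y Fin.≟ a)
  admissible? normal a y = ¬? (y Fin.≟ a)

  Separated : ∀ {m} → (Fin m → Role) → (Fin m → Fin m) → Set
  Separated L f = ∀ a b → L a ≡ special → L b ≡ special → a ≢ b → ¬ Reachable f a b

  record Valid {m} (L : Fin m → Role) (p : Fin 2) (f : Fin m → Fin m) : Set where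
    field
      injective : Injective f
      admissible : ∀ a → Admissible (L a) a (f a)
      separated : Separated L f
      parity : inversionCount (toℕ ∘ f) % 2 ≡ toℕ p

  valid? : ∀ {m} (L : Fin m → Role) p (σ : Fun m) → Dec (Valid L p (lookup σ))
  valid? L p σ with Fin.all? (λ a → Fin.all? λ b → (lookup σ a Fin.≟ lookup σ b) →-dec (a Fin.≟ b))
  ... | no ¬injective = no λ v → ¬injective λ a b → Valid.injective v
  ... | yes injective = map′
    (λ (admissible , separated , parity) → record
      { injective = injective _ _
      ; admissible = admissible
      ; separated = λ a b La Lb a≢b → separated a b La Lb a≢b ∘ reachable⇒sameCycle σ (injective _ _)
      ; parity = parity })
    (λ v → Valid.admissible v , (λ a b La Lb a≢b → Valid.separated v a b La Lb a≢b ∘ sameCycle⇒reachable σ) , Valid.parity v)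
    ((Fin.all? λ a → admissible? (L a) a (lookup σ a))
     ×-dec (Fin.all? λ a → Fin.all? λ b → special? (L a) →-dec special? (L b) →-dec ¬? (a Fin.≟ b) →-dec
              ¬? (Fin.any? λ k → iter σ (toℕ k) a Fin.≟ b))
     ×-dec (inversionCount (toℕ ∘ lookup σ) % 2 ℕ.≟ toℕ p))

  valid-enumeration : ∀ {m} (L : Fin m → Role) p → Enumeration (Valid L p ∘ lookup)
  valid-enumeration {m} L p = filter-enumeration (valid? L p) (allVecs m m) (allVecs-unique m m) (∈-allVecs m m)

  count : ∀ {m} → (Fin m → Role) → Fin 2 → ℕ
  count L p = size (valid-enumeration L p)

  Valid-cong : ∀ {m} {L : Fin m → Role} {p} {f g : Fin m → Fin m} → (∀ x → f x ≡ g x) → Valid L p f → Valid L p g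
  Valid-cong {L = L} {f = f} {g} f≗g v = record
    { injective = λ {x} {y} eq → Valid.injective v (trans (f≗g x) (trans eq (sym (f≗g y))))
    ; admissible = λ a → subst-admissible (L a) (f≗g a) (Valid.admissible v a)
    ; separated = λ a b La Lb a≢b (k , reaches) → Valid.separated v a b La Lb a≢b (k , trans (iterate-cong f≗g k a) reaches)
    ; parity = trans (cong (_% 2) (inversionCount-cong λ x → cong toℕ (sym (f≗g x)))) (Valid.parity v)
    }
    where
    subst-admissible : ∀ ℓ {a y y′} → y ≡ y′ → Admissible ℓ a y → Admissible ℓ a y′
    subst-admissible ℓ refl adm = adm

  Valid-tabulate : ∀ {m} {L : Fin m → Role} {p} {f : Fin m → Fin m} → Valid L p f → Valid L p (lookup (tabulate f))
  Valid-tabulate {f = f} = Valid-cong λ x → sym (lookup∘tabulate f x)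

  tabulate-lookup : ∀ {m} {f : Fin m → Fin m} (σ : Fun m) → (∀ x → f x ≡ lookup σ x) → tabulate f ≡ σ
  tabulate-lookup σ f≗σ = trans (tabulate-cong f≗σ) (tabulate∘lookup σ)

  ZeroDeleted : ∀ {m} → (Fin (suc m) → Fin (suc m)) → (Fin m → Fin m) → Set
  ZeroDeleted s t = ∀ y → s (suc y) ≡ suc (t y) ⊎ (s (suc y) ≡ zero × s zero ≡ suc (t y))

  deleteZero : ∀ {m} → (Fin (suc m) → Fin (suc m)) → Fin m → Fin m
  deleteZero s y with s (suc y) | s zero
  ... | suc z | _ = z
  ... | zero | suc z = z
  ... | zero | zero = y

  deleteZero-deletes : ∀ {m} (s : Fin (suc m) → Fin (suc m)) → (∀ {y} → s (suc y) ≡ zero → s zero ≢ zero)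
    → ZeroDeleted s (deleteZero s)
  deleteZero-deletes s zero-not-fixed y with s (suc y) in sy | s zero
  ... | suc z | _ = inj₁ refl
  ... | zero | suc z = inj₂ (refl , refl)
  ... | zero | zero = ⊥-elim (zero-not-fixed sy refl)

  -- a is the preimage of the new point 0, which is fixed when a = 0
  insertZero : ∀ {m} → Fin (suc m) → (Fin m → Fin m) → Fin (suc m) → Fin (suc m)
  insertZero zero t zero = zero
  insertZero zero t (suc y) = suc (t y)
  insertZero (suc a) t zero = suc (t a)
  insertZero (suc a) t (suc y) with y Fin.≟ a
  ... | yes _ = zero
  ... | no _ = suc (t y)

  insertZero-deletes : ∀ {m} a (t : Fin m → Fin m) → ZeroDeleted (insertZero a t) t
  insertZero-deletes zero t y = inj₁ refl
  insertZero-deletes (suc a) t y with y Fin.≟ a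
  ... | yes refl = inj₂ (refl , refl)
  ... | no _ = inj₁ refl

  insertZero-hits-zero : ∀ {m} a (t : Fin m → Fin m) → insertZero a t a ≡ zero
  insertZero-hits-zero zero t = refl
  insertZero-hits-zero (suc a) t with a Fin.≟ a
  ... | yes _ = refl
  ... | no a≢a = ⊥-elim (a≢a refl)

  insertZero-cong : ∀ {m} a {t t′ : Fin m → Fin m} → (∀ x → t x ≡ t′ x) → ∀ x → insertZero a t x ≡ insertZero a t′ x
  insertZero-cong zero t≗t′ zero = refl
  insertZero-cong zero t≗t′ (suc y) = cong suc (t≗t′ y)
  insertZero-cong (suc a) t≗t′ zero = cong suc (t≗t′ a)
  insertZero-cong (suc a) t≗t′ (suc y) with y Fin.≟ a
  ... | yes _ = refl
  ... | no _ = cong suc (t≗t′ y)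

  insertZero-injective : ∀ {m} a {t : Fin m → Fin m} → Injective t → Injective (insertZero a t)
  insertZero-injective zero t-inj {zero} {zero} eq = refl
  insertZero-injective zero t-inj {suc x} {suc y} eq = cong suc (t-inj (Fin.suc-injective eq))
  insertZero-injective (suc a) t-inj {zero} {zero} eq = refl
  insertZero-injective (suc a) t-inj {zero} {suc y} eq with y Fin.≟ a
  ... | no y≢a = ⊥-elim (y≢a (t-inj (Fin.suc-injective (sym eq))))
  insertZero-injective (suc a) t-inj {suc x} {zero} eq with x Fin.≟ a
  ... | no x≢a = ⊥-elim (x≢a (t-inj (Fin.suc-injective eq)))
  insertZero-injective (suc a) t-inj {suc x} {suc y} eq with x Fin.≟ a | y Fin.≟ a
  ... | yes refl | yes refl = refl
  ... | no x≢a | no y≢a = cong suc (t-inj (Fin.suc-injective eq))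

  module _ {m} {s : Fin (suc m) → Fin (suc m)} {t : Fin m → Fin m} (deleted : ZeroDeleted s t) where

    ZeroDeleted-unique : ∀ {t′} → ZeroDeleted s t′ → ∀ y → t y ≡ t′ y
    ZeroDeleted-unique deleted′ y with deleted y | deleted′ y
    ... | inj₁ e | inj₁ e′ = Fin.suc-injective (trans (sym e) e′)
    ... | inj₂ (_ , e) | inj₂ (_ , e′) = Fin.suc-injective (trans (sym e) e′)
    ... | inj₁ e | inj₂ (e′ , _) with () ← trans (sym e) e′
    ... | inj₂ (e , _) | inj₁ e′ with () ← trans (sym e) e′

    insertZero-restores : Injective s → ∀ {a} → s a ≡ zero → ∀ x → insertZero a t x ≡ s x
    insertZero-restores s-inj {zero} s0≡0 zero = sym s0≡0
    insertZero-restores s-inj {zero} s0≡0 (suc y) with deleted y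
    ... | inj₁ e = sym e
    ... | inj₂ (e , _) with () ← s-inj (trans e (sym s0≡0))
    insertZero-restores s-inj {suc a} sa≡0 zero with deleted a
    ... | inj₁ e with () ← trans (sym sa≡0) e
    ... | inj₂ (_ , e) = sym e
    insertZero-restores s-inj {suc a} sa≡0 (suc y) with y Fin.≟ a
    ... | yes refl = sym sa≡0
    ... | no y≢a with deleted y
    ...   | inj₁ e = sym e
    ...   | inj₂ (e , _) = ⊥-elim (y≢a (Fin.suc-injective (s-inj (trans e (sym sa≡0)))))

    deleted-injective : Injective s → Injective t
    deleted-injective s-inj {x} {y} eq with deleted x | deleted y
    ... | inj₁ ex | inj₁ ey = Fin.suc-injective (s-inj (trans ex (trans (cong suc eq) (sym ey))))
    ... | inj₂ (ex , _) | inj₂ (ey , _) = Fin.suc-injective (s-inj (trans ex (sym ey)))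
    ... | inj₁ ex | inj₂ (_ , ey) with () ← s-inj (trans ex (trans (cong suc eq) (sym ey)))
    ... | inj₂ (_ , ex) | inj₁ ey with () ← s-inj (trans ey (trans (cong suc (sym eq)) (sym ex)))

    reachable-up : ∀ k x → Reachable s (suc x) (suc (iterate t k x))
    reachable-up zero x = zero , refl
    reachable-up (suc k) x with reachable-up k x | deleted (iterate t k x)
    ... | j , reaches | inj₁ e = suc j , trans (cong s reaches) e
    ... | j , reaches | inj₂ (e , e′) = suc (suc j) , trans (cong s (trans (cong s reaches) e)) e′

    reachable-down : ∀ k x y → iterate s k (suc x) ≡ suc y → Reachable t x y
    reachable-down zero x y reaches = zero , Fin.suc-injective reaches
    reachable-down (suc k) x y reaches with deleted x
    ... | inj₁ e with reachable-down k (t x) y (trans (cong (iterate s k) (sym e)) (trans (sym (iterate-suc s k (suc x))) reaches))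
    ...   | j , reaches′ = suc j , trans (iterate-suc t j x) reaches′
    reachable-down (suc zero) x y reaches | inj₂ (e , _) with () ← trans (sym e) reaches
    reachable-down (suc (suc k)) x y reaches | inj₂ (e , e′)
      with reachable-down k (t x) y (trans (cong (iterate s k) (sym e′)) (trans (sym (iterate-suc s k zero))
             (trans (cong (iterate s (suc k)) (sym e)) (trans (sym (iterate-suc s (suc k) (suc x))) reaches))))
    ... | j , reaches′ = suc j , trans (iterate-suc t j x) reaches′

  deleteZero-cong : ∀ {m} {s s′ : Fin (suc m) → Fin (suc m)} → (∀ x → s x ≡ s′ x) → ∀ y → deleteZero s y ≡ deleteZero s′ y
  deleteZero-cong s≗s′ y rewrite s≗s′ (suc y) | s≗s′ zero = refl

  deleteZero-insertZero : ∀ {m} a (t : Fin m → Fin m) y → deleteZero (insertZero a t) y ≡ t y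
  deleteZero-insertZero a t = ZeroDeleted-unique {s = insertZero a t} (deleteZero-deletes (insertZero a t) (zero-moved a)) (insertZero-deletes a t)
    where
    zero-moved : ∀ a {y} → insertZero a t (suc y) ≡ zero → insertZero a t zero ≢ zero
    zero-moved zero ()
    zero-moved (suc a) _ ()

  preimageZero : ∀ {m} → (Fin (suc m) → Fin (suc m)) → Fin (suc m)
  preimageZero s with Fin.any? (λ x → s x Fin.≟ zero)
  ... | yes (x , _) = x
  ... | no _ = zero

  preimageZero-preimage : ∀ {m} {s : Fin (suc m) → Fin (suc m)} → Injective s → s (preimageZero s) ≡ zero
  preimageZero-preimage {s = s} s-injective with Fin.any? (λ x → s x Fin.≟ zero)
  ... | yes (_ , sx≡0) = sx≡0
  ... | no miss = ⊥-elim (miss (injective⇒surjective s-injective zero))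

  preimageZero-unique : ∀ {m} {s : Fin (suc m) → Fin (suc m)} → Injective s → ∀ {x} → s x ≡ zero → preimageZero s ≡ x
  preimageZero-unique s-injective sx≡0 = s-injective (trans (preimageZero-preimage s-injective) (sym sx≡0))

  toggle : Fin 2 → Fin 2
  toggle zero = suc zero
  toggle (suc zero) = zero

  parity-suc : ∀ x p → x % 2 ≡ toℕ (toggle p) → suc x % 2 ≡ toℕ p
  parity-suc zero zero ()
  parity-suc zero (suc zero) _ = refl
  parity-suc (suc zero) zero _ = refl
  parity-suc (suc zero) (suc zero) ()
  parity-suc (suc (suc x)) p eq = parity-suc x p eq

  parity-suc⁻ : ∀ x p → suc x % 2 ≡ toℕ p → x % 2 ≡ toℕ (toggle p)
  parity-suc⁻ zero zero ()
  parity-suc⁻ zero (suc zero) _ = refl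
  parity-suc⁻ (suc zero) zero _ = refl
  parity-suc⁻ (suc zero) (suc zero) ()
  parity-suc⁻ (suc (suc x)) p eq = parity-suc⁻ x p eq

  parity-even-shift : ∀ x k → (x + 2 * k) % 2 ≡ x % 2
  parity-even-shift x k = trans (cong (λ z → (x + z) % 2) (ℕ.*-comm 2 k)) ([m+kn]%n≡m%n x k 2)

  fixing : ∀ {m} → Fin m → (Fin m → Role) → Fin m → Role
  fixing a L = updateAt L a (λ _ → fixed)

  admissible-suc : ∀ {m} ℓ {a y : Fin m} → Admissible ℓ (suc a) (suc y) → Admissible ℓ a y
  admissible-suc fixed eq = Fin.suc-injective eq
  admissible-suc special y≢a = y≢a ∘ cong suc
  admissible-suc normal y≢a = y≢a ∘ cong suc

  admissible-suc⁻ : ∀ {m} ℓ {a y : Fin m} → Admissible ℓ a y → Admissible ℓ (suc a) (suc y)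
  admissible-suc⁻ fixed eq = cong suc eq
  admissible-suc⁻ special y≢a = y≢a ∘ Fin.suc-injective
  admissible-suc⁻ normal y≢a = y≢a ∘ Fin.suc-injective

  admissible-moving : ∀ {m} ℓ {a y : Fin m} → ℓ ≢ fixed → y ≢ a → Admissible ℓ a y
  admissible-moving fixed ℓ≢fixed _ = ⊥-elim (ℓ≢fixed refl)
  admissible-moving special _ y≢a = y≢a
  admissible-moving normal _ y≢a = y≢a

  admissible-moving⁻ : ∀ {m} ℓ {a y : Fin m} → Admissible ℓ a y → y ≢ a → ℓ ≢ fixed
  admissible-moving⁻ fixed y≡a y≢a _ = y≢a y≡a
  admissible-moving⁻ special _ _ ()
  admissible-moving⁻ normal _ _ ()

  admissible-moves : ∀ {m} ℓ {a y : Fin m} → ℓ ≢ fixed → Admissible ℓ a y → y ≢ a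
  admissible-moves fixed ℓ≢fixed _ = ⊥-elim (ℓ≢fixed refl)
  admissible-moves special _ y≢a = y≢a
  admissible-moves normal _ y≢a = y≢a

  admissible-role : ∀ {m} {ℓ ℓ′} {a y : Fin m} → ℓ ≡ ℓ′ → Admissible ℓ a y → Admissible ℓ′ a y
  admissible-role refl adm = adm

  separated-unfix : ∀ {m} {L : Fin m → Role} {f : Fin m → Fin m} {a} → Injective f → f a ≡ a
    → Separated (fixing a L) f → Separated L f
  separated-unfix {L = L} {f} {a} f-injective fa≡a sep x y x-special y-special x≢y (k , reaches) with x Fin.≟ a | y Fin.≟ a
  ... | yes refl | _ = x≢y (trans (sym (iterate-fixed fa≡a k)) reaches)
  ... | no x≢a | yes refl = x≢a (reaches-fixed f-injective fa≡a k x reaches)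
  ... | no x≢a | no y≢a =
    sep x y (trans (updateAt-minimal x a L x≢a) x-special) (trans (updateAt-minimal y a L y≢a) y-special) x≢y (k , reaches)

  module DeleteNormal {m} {s : Fin (suc m) → Fin (suc m)} {t : Fin m → Fin m} (deleted : ZeroDeleted s t)
    (s-injective : Injective s) {a : Fin m} (s-a : s (suc a) ≡ zero) where

    t-injective : Injective t
    t-injective = deleted-injective deleted s-injective

    s-zero : s zero ≡ suc (t a)
    s-zero with deleted a
    ... | inj₁ e with () ← trans (sym s-a) e
    ... | inj₂ (_ , e) = e

    s-other : ∀ y → y ≢ a → s (suc y) ≡ suc (t y)
    s-other y y≢a with deleted y
    ... | inj₁ e = e
    ... | inj₂ (e , _) = ⊥-elim (y≢a (Fin.suc-injective (s-injective (trans e (sym s-a)))))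

    private
      module S = Splice (toℕ ∘ s) (toℕ ∘ t) a (cong toℕ s-zero) (cong toℕ s-a)
        (λ y y≢a → cong toℕ (s-other y y≢a)) (t-injective ∘ Fin.toℕ-injective)
        (∑-below-injective t-injective (toℕ (t a)) (ℕ.<⇒≤ (Fin.toℕ<n (t a))))

      odd-change : ∃ λ k → inversionCount (toℕ ∘ s) ≡ suc (inversionCount (toℕ ∘ t) + 2 * k)
      odd-change = S.smallerLeft , S.inversionCount-splice

    parity-down : ∀ {p} → inversionCount (toℕ ∘ s) % 2 ≡ toℕ p → inversionCount (toℕ ∘ t) % 2 ≡ toℕ (toggle p)
    parity-down {p} s-parity with odd-change
    ... | k , eq = parity-suc⁻ (inversionCount (toℕ ∘ t)) p
      (trans (sym (parity-even-shift (suc (inversionCount (toℕ ∘ t))) k)) (trans (cong (_% 2) (sym eq)) s-parity))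

    parity-up : ∀ {p} → inversionCount (toℕ ∘ t) % 2 ≡ toℕ (toggle p) → inversionCount (toℕ ∘ s) % 2 ≡ toℕ p
    parity-up {p} t-parity with odd-change
    ... | k , eq = trans (cong (_% 2) eq)
      (trans (parity-even-shift (suc (inversionCount (toℕ ∘ t))) k) (parity-suc (inversionCount (toℕ ∘ t)) p t-parity))

    module _ {L : Fin (suc m) → Role} (L-zero : L zero ≡ normal) {p : Fin 2} where

      separated-down : ∀ {L″ : Fin m → Role} → (∀ x → L″ x ≡ special → L (suc x) ≡ special) → Separated L s → Separated L″ t
      separated-down special⇒special s-sep x y x-special y-special x≢y (k , reaches) =
        s-sep (suc x) (suc y) (special⇒special x x-special) (special⇒special y y-special) (x≢y ∘ Fin.suc-injective)
          (let j , reaches′ = reachable-up deleted k x in j , trans reaches′ (cong suc reaches))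

      role-a-moving : Valid L p s → L (suc a) ≢ fixed
      role-a-moving v = admissible-moving⁻ (L (suc a)) (Valid.admissible v (suc a)) (Fin.0≢1+n ∘ trans (sym s-a))

      private
        admissible-other : Valid L p s → ∀ y → y ≢ a → Admissible (L (suc y)) y (t y)
        admissible-other v y y≢a = admissible-suc (L (suc y)) (subst (Admissible (L (suc y)) (suc y)) (s-other y y≢a) (Valid.admissible v (suc y)))

      delete-moving : Valid L p s → s zero ≢ suc a → Valid (L ∘ suc) (toggle p) t
      delete-moving v s0≢a = record
        { injective = t-injective
        ; admissible = admissible
        ; separated = separated-down (λ _ x-special → x-special) (Valid.separated v)
        ; parity = parity-down (Valid.parity v)
        }
        where
        admissible : ∀ y → Admissible (L (suc y)) y (t y)
        admissible y with y Fin.≟ a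
        ... | yes refl = admissible-moving (L (suc a)) (role-a-moving v) (λ ta≡a → s0≢a (trans s-zero (cong suc ta≡a)))
        ... | no y≢a = admissible-other v y y≢a

      delete-2cycle : Valid L p s → s zero ≡ suc a → Valid (fixing a (L ∘ suc)) (toggle p) t
      delete-2cycle v s0≡a = record
        { injective = t-injective
        ; admissible = admissible
        ; separated = separated-down still-special (Valid.separated v)
        ; parity = parity-down (Valid.parity v)
        }
        where
        admissible : ∀ y → Admissible (fixing a (L ∘ suc) y) y (t y)
        admissible y with y Fin.≟ a
        ... | yes refl = admissible-role (sym (updateAt-updates a (L ∘ suc))) (Fin.suc-injective (trans (sym s-zero) s0≡a))
        ... | no y≢a = admissible-role (sym (updateAt-minimal y a (L ∘ suc) y≢a)) (admissible-other v y y≢a)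
        still-special : ∀ x → fixing a (L ∘ suc) x ≡ special → L (suc x) ≡ special
        still-special x x-special with x Fin.≟ a
        ... | yes refl with () ← trans (sym (updateAt-updates a (L ∘ suc))) x-special
        ... | no x≢a = trans (sym (updateAt-minimal x a (L ∘ suc) x≢a)) x-special

      private
        admissible-up : L (suc a) ≢ fixed → (∀ y → y ≢ a → Admissible (L (suc y)) y (t y)) → ∀ x → Admissible (L x) x (s x)
        admissible-up a-moving _ zero = admissible-role (sym L-zero) λ s0≡0 → Fin.0≢1+n (trans (sym s0≡0) s-zero)
        admissible-up a-moving t-admissible (suc y) with y Fin.≟ a
        ... | yes refl = admissible-moving (L (suc a)) a-moving (Fin.0≢1+n ∘ trans (sym s-a))
        ... | no y≢a = subst (Admissible (L (suc y)) (suc y)) (sym (s-other y y≢a)) (admissible-suc⁻ (L (suc y)) (t-admissible y y≢a))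

        zero-not-special : L zero ≢ special
        zero-not-special zero-special with () ← trans (sym L-zero) zero-special

        separated-up : Separated (L ∘ suc) t → Separated L s
        separated-up t-sep zero _ zero-special = ⊥-elim (zero-not-special zero-special)
        separated-up t-sep (suc x) zero _ zero-special = ⊥-elim (zero-not-special zero-special)
        separated-up t-sep (suc x) (suc y) x-special y-special x≢y (k , reaches) =
          t-sep x y x-special y-special (x≢y ∘ cong suc) (reachable-down deleted k x y reaches)

      insert-moving : L (suc a) ≢ fixed → Valid (L ∘ suc) (toggle p) t → Valid L p s
      insert-moving a-moving v = record
        { injective = s-injective
        ; admissible = admissible-up a-moving (λ y _ → Valid.admissible v y)
        ; separated = separated-up (Valid.separated v)
        ; parity = parity-up (Valid.parity v)
        }

      insert-2cycle : L (suc a) ≢ fixed → Valid (fixing a (L ∘ suc)) (toggle p) t → Valid L p s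
      insert-2cycle a-moving v = record
        { injective = s-injective
        ; admissible = admissible-up a-moving λ y y≢a →
            admissible-role (updateAt-minimal y a (L ∘ suc) y≢a) (Valid.admissible v y)
        ; separated = separated-up (separated-unfix (Valid.injective v) ta≡a (Valid.separated v))
        ; parity = parity-up (Valid.parity v)
        }
        where
        ta≡a : t a ≡ a
        ta≡a = admissible-role (updateAt-updates a (L ∘ suc)) (Valid.admissible v a)

  module DeleteFixed {m} {s : Fin (suc m) → Fin (suc m)} {t : Fin m → Fin m} (deleted : ZeroDeleted s t)
    (s-zero : s zero ≡ zero) {L : Fin (suc m) → Role} (L-zero : L zero ≡ fixed) {p : Fin 2} where

    s-suc : ∀ y → s (suc y) ≡ suc (t y)
    s-suc y with deleted y
    ... | inj₁ e = e
    ... | inj₂ (_ , e) with () ← trans (sym s-zero) e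

    private
      same-inversions : inversionCount (toℕ ∘ s) ≡ inversionCount (toℕ ∘ t)
      same-inversions = inversionCount-fixed-zero (toℕ ∘ s) (toℕ ∘ t) (cong toℕ s-zero) (cong toℕ ∘ s-suc)

      zero-not-special : L zero ≢ special
      zero-not-special zero-special with () ← trans (sym L-zero) zero-special

    delete-fixed : Valid L p s → Valid (L ∘ suc) p t
    delete-fixed v = record
      { injective = deleted-injective deleted (Valid.injective v)
      ; admissible = λ y → admissible-suc (L (suc y)) (subst (Admissible (L (suc y)) (suc y)) (s-suc y) (Valid.admissible v (suc y)))
      ; separated = λ x y x-special y-special x≢y (k , reaches) → Valid.separated v (suc x) (suc y) x-special y-special (x≢y ∘ Fin.suc-injective)
          (let j , reaches′ = reachable-up deleted k x in j , trans reaches′ (cong suc reaches))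
      ; parity = trans (cong (_% 2) (sym same-inversions)) (Valid.parity v)
      }

    insert-fixed : Injective s → Valid (L ∘ suc) p t → Valid L p s
    insert-fixed s-injective v = record
      { injective = s-injective
      ; admissible = admissible
      ; separated = separated
      ; parity = trans (cong (_% 2) same-inversions) (Valid.parity v)
      }
      where
      admissible : ∀ x → Admissible (L x) x (s x)
      admissible zero = admissible-role (sym L-zero) s-zero
      admissible (suc y) = subst (Admissible (L (suc y)) (suc y)) (sym (s-suc y)) (admissible-suc⁻ (L (suc y)) (Valid.admissible v y))
      separated : Separated L s
      separated zero _ zero-special = ⊥-elim (zero-not-special zero-special)
      separated (suc x) zero _ zero-special = ⊥-elim (zero-not-special zero-special)
      separated (suc x) (suc y) x-special y-special x≢y (k , reaches) =
        Valid.separated v x y x-special y-special (x≢y ∘ cong suc) (reachable-down deleted k x y reaches)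

  count-fixed : ∀ {m} {L : Fin (suc m) → Role} → L zero ≡ fixed → ∀ p → count L p ≡ count (L ∘ suc) p
  count-fixed {m} {L} L-zero p = bijection⇒size≡ (valid-enumeration L p) (valid-enumeration (L ∘ suc) p)
    (λ σ → tabulate (deleteZero (lookup σ))) (λ τ → tabulate (insertZero zero (lookup τ)))
    (λ {σ} v → Valid-tabulate (DeleteFixed.delete-fixed (deleted {σ} v) (s-zero {σ} v) L-zero v))
    (λ {τ} v → Valid-tabulate (DeleteFixed.insert-fixed (insertZero-deletes zero (lookup τ)) refl L-zero
                                 (insertZero-injective zero (Valid.injective v)) v))
    (λ {σ} v → tabulate-lookup σ λ x →
       trans (insertZero-cong zero (lookup∘tabulate (deleteZero (lookup σ))) x) (insertZero-restores (deleted {σ} v) (Valid.injective v) (s-zero {σ} v) x))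
    (λ {τ} _ → tabulate-lookup τ λ y →
       trans (deleteZero-cong (lookup∘tabulate (insertZero zero (lookup τ))) y) (deleteZero-insertZero zero (lookup τ) y))
    where
    module _ {σ : Fun (suc m)} (v : Valid L p (lookup σ)) where
      s-zero : lookup σ zero ≡ zero
      s-zero = admissible-role L-zero (Valid.admissible v zero)

      deleted : ZeroDeleted (lookup σ) (deleteZero (lookup σ))
      deleted = deleteZero-deletes (lookup σ) λ sy≡0 _ → Fin.0≢1+n (sym (Valid.injective v (trans sy≡0 (sym s-zero))))

  private
    tagged : ∀ {A P : Set} → Dec P → A → A ⊎ A
    tagged (yes _) = inj₂
    tagged (no _) = inj₁

    reduce-tagged : ∀ {A P : Set} (d : Dec P) (x : A) → reduce (tagged d x) ≡ x
    reduce-tagged (yes _) x = refl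
    reduce-tagged (no _) x = refl

  module CountNormal {m} {L : Fin (suc m) → Role} (L-zero : L zero ≡ normal) (p : Fin 2) where

    Deletion : Fin (suc m) → Fun m ⊎ Fun m → Set
    Deletion zero _ = ⊥
    Deletion (suc a) x = L (suc a) ≢ fixed × [ Valid (L ∘ suc) (toggle p) ∘ lookup , Valid (fixing a (L ∘ suc)) (toggle p) ∘ lookup ] x

    deletion-enumeration : ∀ a → Enumeration (Deletion a)
    deletion-enumeration zero = empty-enumeration λ ()
    deletion-enumeration (suc a) = guard-enumeration (¬? (fixed? (L (suc a))))
      (⊎-enumeration (valid-enumeration (L ∘ suc) (toggle p)) (valid-enumeration (fixing a (L ∘ suc)) (toggle p)))

    private
      delete : Fun (suc m) → Fin (suc m) × (Fun m ⊎ Fun m)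
      delete σ = let s = lookup σ in preimageZero s , tagged (s zero Fin.≟ preimageZero s) (tabulate (deleteZero s))

      insert : Fin (suc m) × (Fun m ⊎ Fun m) → Fun (suc m)
      insert (a , x) = tabulate (insertZero a (lookup (reduce x)))

      module _ {σ : Fun (suc m)} (v : Valid L p (lookup σ)) where
        zero-moved : lookup σ zero ≢ zero
        zero-moved = admissible-role L-zero (Valid.admissible v zero)

        deleted : ZeroDeleted (lookup σ) (deleteZero (lookup σ))
        deleted = deleteZero-deletes (lookup σ) λ _ → zero-moved

        delete-valid : uncurry Deletion (delete σ)
        delete-valid = classify (preimageZero (lookup σ)) (preimageZero-preimage (Valid.injective v)) _
          where
          classify : ∀ q → lookup σ q ≡ zero → (d : Dec (lookup σ zero ≡ q))
            → uncurry Deletion (q , tagged d (tabulate (deleteZero (lookup σ))))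
          classify zero s0≡0 _ = ⊥-elim (zero-moved s0≡0)
          classify (suc a) sa≡0 (yes s0≡a) =
            DeleteNormal.role-a-moving deleted (Valid.injective v) sa≡0 L-zero v ,
            Valid-tabulate (DeleteNormal.delete-2cycle deleted (Valid.injective v) sa≡0 L-zero v s0≡a)
          classify (suc a) sa≡0 (no s0≢a) =
            DeleteNormal.role-a-moving deleted (Valid.injective v) sa≡0 L-zero v ,
            Valid-tabulate (DeleteNormal.delete-moving deleted (Valid.injective v) sa≡0 L-zero v s0≢a)

        insert-delete : insert (delete σ) ≡ σ
        insert-delete = tabulate-lookup σ λ x → trans
          (cong (λ τ → insertZero (preimageZero (lookup σ)) (lookup τ) x)
            (reduce-tagged (lookup σ zero Fin.≟ preimageZero (lookup σ)) (tabulate (deleteZero (lookup σ)))))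
          (trans (insertZero-cong (preimageZero (lookup σ)) (lookup∘tabulate (deleteZero (lookup σ))) x)
            (insertZero-restores deleted (Valid.injective v) (preimageZero-preimage (Valid.injective v)) x))

      insert-valid : ∀ {y} → uncurry Deletion y → Valid L p (lookup (insert y))
      insert-valid {suc a , inj₁ τ} (moving , v) = Valid-tabulate (DeleteNormal.insert-moving
        (insertZero-deletes (suc a) (lookup τ)) (insertZero-injective (suc a) (Valid.injective v)) (insertZero-hits-zero (suc a) (lookup τ))
        L-zero moving v)
      insert-valid {suc a , inj₂ τ} (moving , v) = Valid-tabulate (DeleteNormal.insert-2cycle
        (insertZero-deletes (suc a) (lookup τ)) (insertZero-injective (suc a) (Valid.injective v)) (insertZero-hits-zero (suc a) (lookup τ))
        L-zero moving v)

      module Reinsert (a : Fin m) (x : Fun m ⊎ Fun m) (s-injective : Injective (lookup (insert (suc a , x)))) where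
        t = lookup (reduce x)
        s = lookup (insert (suc a , x))

        preimage : preimageZero s ≡ suc a
        preimage = preimageZero-unique s-injective (trans (lookup∘tabulate (insertZero (suc a) t) (suc a)) (insertZero-hits-zero (suc a) t))

        restored : tabulate (deleteZero s) ≡ reduce x
        restored = tabulate-lookup (reduce x) λ y →
          trans (deleteZero-cong (lookup∘tabulate (insertZero (suc a) t)) y) (deleteZero-insertZero (suc a) t y)

        s-zero : s zero ≡ suc (t a)
        s-zero = lookup∘tabulate (insertZero (suc a) t) zero

        reinsert : (∀ (d : Dec (s zero ≡ suc a)) → tagged d (reduce x) ≡ x) → delete (insert (suc a , x)) ≡ (suc a , x)
        reinsert tag rewrite preimage | restored = cong (suc a ,_) (tag (s zero Fin.≟ suc a))

      delete-insert : ∀ {y} → uncurry Deletion y → delete (insert y) ≡ y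
      delete-insert {suc a , inj₁ τ} d@(moving , v) = R.reinsert tag
        where
        module R = Reinsert a (inj₁ τ) (Valid.injective (insert-valid {suc a , inj₁ τ} d))
        tag : ∀ (d : Dec (R.s zero ≡ suc a)) → tagged d τ ≡ inj₁ τ
        tag (yes s0≡a) = ⊥-elim (admissible-moves (L (suc a)) moving (Valid.admissible v a) (Fin.suc-injective (trans (sym R.s-zero) s0≡a)))
        tag (no _) = refl
      delete-insert {suc a , inj₂ τ} d@(moving , v) = R.reinsert tag
        where
        module R = Reinsert a (inj₂ τ) (Valid.injective (insert-valid {suc a , inj₂ τ} d))
        tag : ∀ (d : Dec (R.s zero ≡ suc a)) → tagged d τ ≡ inj₂ τ
        tag (yes _) = refl
        tag (no s0≢a) = ⊥-elim (s0≢a (trans R.s-zero (cong suc (admissible-role (updateAt-updates a (L ∘ suc)) (Valid.admissible v a)))))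

    count-normal-Σ : count L p ≡ size (Σ-enumeration deletion-enumeration)
    count-normal-Σ = bijection⇒size≡ (valid-enumeration L p) (Σ-enumeration deletion-enumeration) delete insert
      (λ {σ} → delete-valid {σ}) insert-valid (λ {σ} → insert-delete {σ}) delete-insert

    count-normal : count L p ≡ sum λ a → 𝟙[ ¬? (fixed? (L (suc a))) ] * (count (L ∘ suc) (toggle p) + count (fixing a (L ∘ suc)) (toggle p))
    count-normal = trans count-normal-Σ (trans (size-Σ deletion-enumeration) (sum-cong-≗ size-deletion))
      where
      size-deletion : ∀ a → size (deletion-enumeration (suc a))
        ≡ 𝟙[ ¬? (fixed? (L (suc a))) ] * (count (L ∘ suc) (toggle p) + count (fixing a (L ∘ suc)) (toggle p))
      size-deletion a with fixed? (L (suc a))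
      ... | no _ = trans (size-⊎ (valid-enumeration (L ∘ suc) (toggle p)) (valid-enumeration (fixing a (L ∘ suc)) (toggle p)))
                      (sym (ℕ.+-identityʳ _))
      ... | yes _ = refl

  count-special-only : ∀ {m} {L : Fin (suc m) → Role} → L zero ≡ special → (∀ b → L b ≢ normal) → ∀ p → count L p ≡ 0
  count-special-only {L = L} L-zero no-normal p = size-empty (valid-enumeration L p) (λ {σ} → no-valid {σ})
    where
    no-valid : ∀ {σ} → ¬ Valid L p (lookup σ)
    no-valid {σ} v with L (lookup σ zero) in L-w
    ... | special = Valid.separated v zero w L-zero L-w (zero-moved ∘ sym) (1 , refl)
      where
      w = lookup σ zero
      zero-moved : w ≢ zero
      zero-moved = admissible-role L-zero (Valid.admissible v zero)
    ... | normal = no-normal _ L-w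
    ... | fixed = admissible-role L-zero (Valid.admissible v zero)
                    (Valid.injective v (admissible-role L-w (Valid.admissible v (lookup σ zero))))

  separatedDerangements : ℕ → ℕ → Fin 2 → ℕ
  separatedDerangements s (suc zero) p =
    s * separatedDerangements s 0 (toggle p) + s * separatedDerangements (ℕ.pred s) 0 (toggle p)
  separatedDerangements s (suc (suc n)) p =
    (s + suc n) * separatedDerangements s (suc n) (toggle p) + s * separatedDerangements (ℕ.pred s) (suc n) (toggle p)
    + suc n * separatedDerangements s n (toggle p)
  separatedDerangements zero zero zero = 1
  separatedDerangements zero zero (suc _) = 0
  separatedDerangements (suc _) zero _ = 0

  separatedDerangements-suc : ∀ s n p → separatedDerangements s (suc n) p
    ≡ (s + n) * separatedDerangements s n (toggle p) + s * separatedDerangements (ℕ.pred s) n (toggle p)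
      + n * separatedDerangements s (ℕ.pred n) (toggle p)
  separatedDerangements-suc s zero p rewrite ℕ.+-identityʳ s = sym (ℕ.+-identityʳ _)
  separatedDerangements-suc s (suc n) p = refl

  count-none : ∀ (L : Fin 0 → Role) p → count L p ≡ separatedDerangements 0 0 p
  count-none L zero = cong length (filter-accept (valid? L zero) {x = Vec.[]} {xs = List.[]} record
    { injective = λ {x} → ⊥-elim (Fin.¬Fin0 x) ; admissible = λ () ; separated = λ () ; parity = refl })
  count-none L (suc zero) = cong length (filter-reject (valid? L (suc zero)) {x = Vec.[]} {xs = List.[]} λ v → case Valid.parity v of λ ())

  isSpecial isNormal : Role → ℕ
  isSpecial special = 1
  isSpecial _ = 0
  isNormal normal = 1
  isNormal _ = 0

  #special #normal : ∀ {m} → (Fin m → Role) → ℕ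
  #special L = sum (isSpecial ∘ L)
  #normal L = sum (isNormal ∘ L)

  sum-fixing : ∀ {m} (w : Role → ℕ) → w fixed ≡ 0 → (L : Fin m → Role) (a : Fin m)
    → sum (w ∘ fixing a L) + w (L a) ≡ sum (w ∘ L)
  sum-fixing w w-fixed L zero = trans (cong (λ z → z + sum (w ∘ L ∘ suc) + w (L zero)) w-fixed) (ℕ.+-comm _ (w (L zero)))
  sum-fixing w w-fixed L (suc a) = trans (ℕ.+-assoc (w (L zero)) _ _) (cong (w (L zero) +_) (sum-fixing w w-fixed (L ∘ suc) a))

  -- ensures that 0 is normal as long as some point is
  Ordered : ∀ {m} → (Fin m → Role) → Set
  Ordered L = ∀ a b → L a ≡ special → L b ≡ normal → toℕ b < toℕ a

  Ordered-suc : ∀ {m} {L : Fin (suc m) → Role} → Ordered L → Ordered (L ∘ suc)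
  Ordered-suc ordered a b a-special b-normal = ℕ.≤-pred (ordered (suc a) (suc b) a-special b-normal)

  Ordered-fixing : ∀ {m} {L : Fin m → Role} a → Ordered L → Ordered (fixing a L)
  Ordered-fixing {L = L} a ordered x y x-special y-normal =
    ordered x y (unfixed x x-special λ ()) (unfixed y y-normal λ ())
    where
    unfixed : ∀ {ℓ} x → fixing a L x ≡ ℓ → ℓ ≢ fixed → L x ≡ ℓ
    unfixed x eq ℓ≢fixed with x Fin.≟ a
    ... | yes refl = ⊥-elim (ℓ≢fixed (trans (sym eq) (updateAt-updates a L)))
    ... | no x≢a = trans (sym (updateAt-minimal x a L x≢a)) eq

  count≡separatedDerangements : ∀ {m} (L : Fin m → Role) → Ordered L → ∀ p
    → count L p ≡ separatedDerangements (#special L) (#normal L) p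
  count≡separatedDerangements {zero} L _ p = count-none L p
  count≡separatedDerangements {suc m} L ordered p = by-role (L zero) refl
    where
    open +-*-Solver
    L′ = L ∘ suc
    S = #special L′
    N = #normal L′
    p′ = toggle p

    IH : ∀ (L″ : Fin m → Role) → Ordered L″ → ∀ p → count L″ p ≡ separatedDerangements (#special L″) (#normal L″) p
    IH = count≡separatedDerangements

    d dₛ dₙ : ℕ
    d = separatedDerangements S N p′
    dₛ = separatedDerangements (ℕ.pred S) N p′
    dₙ = separatedDerangements S (ℕ.pred N) p′

    count-L′ : count L′ p′ ≡ d
    count-L′ = IH L′ (Ordered-suc ordered) p′

    counts-fixing : ∀ (w : Role → ℕ) → w fixed ≡ 0 → ∀ {a ℓ} → L′ a ≡ ℓ → sum (w ∘ fixing a L′) + w ℓ ≡ sum (w ∘ L′)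
    counts-fixing w w-fixed {a} refl = sum-fixing w w-fixed L′ a

    count-fixing : ∀ a → count (fixing a L′) p′ ≡ separatedDerangements (#special (fixing a L′)) (#normal (fixing a L′)) p′
    count-fixing a = IH (fixing a L′) (Ordered-fixing a (Ordered-suc ordered)) p′

    count-fixing-special : ∀ {a} → L′ a ≡ special → count (fixing a L′) p′ ≡ dₛ
    count-fixing-special {a} L-a = trans (count-fixing a) (cong₂ (λ s n → separatedDerangements s n p′)
      (cong ℕ.pred (trans (ℕ.+-comm 1 _) (counts-fixing isSpecial refl L-a)))
      (trans (sym (ℕ.+-identityʳ _)) (counts-fixing isNormal refl L-a)))

    count-fixing-normal : ∀ {a} → L′ a ≡ normal → count (fixing a L′) p′ ≡ dₙ
    count-fixing-normal {a} L-a = trans (count-fixing a) (cong₂ (λ s n → separatedDerangements s n p′)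
      (trans (sym (ℕ.+-identityʳ _)) (counts-fixing isSpecial refl L-a))
      (cong ℕ.pred (trans (ℕ.+-comm 1 _) (counts-fixing isNormal refl L-a))))

    deletion-count : ∀ a → 𝟙[ ¬? (fixed? (L′ a)) ] * (count L′ p′ + count (fixing a L′) p′)
                         ≡ (d + dₛ) * isSpecial (L′ a) + (d + dₙ) * isNormal (L′ a)
    deletion-count a with L′ a in L-a
    ... | special = trans (cong₂ (λ u v → 1 * (u + v)) count-L′ (count-fixing-special L-a))
                      (solve 2 (λ u v → con 1 :* u := u :* con 1 :+ v :* con 0) refl (d + dₛ) (d + dₙ))
    ... | normal = trans (cong₂ (λ u v → 1 * (u + v)) count-L′ (count-fixing-normal L-a))
                     (solve 2 (λ u v → con 1 :* v := u :* con 0 :+ v :* con 1) refl (d + dₛ) (d + dₙ))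
    ... | fixed = sym (cong₂ _+_ (ℕ.*-zeroʳ (d + dₛ)) (ℕ.*-zeroʳ (d + dₙ)))

    by-role : ∀ ℓ → L zero ≡ ℓ → count L p ≡ separatedDerangements (isSpecial ℓ + S) (isNormal ℓ + N) p
    by-role fixed L-zero = trans (count-fixed {L = L} L-zero p) (IH L′ (Ordered-suc ordered) p)
    by-role special L-zero =
      trans (count-special-only {L = L} L-zero no-normal p) (cong (λ n → separatedDerangements (suc S) n p) (sym none-normal))
      where
      no-normal : ∀ b → L b ≢ normal
      no-normal b b-normal = ℕ.n≮0 (ordered zero b L-zero b-normal)
      none-normal : N ≡ 0
      none-normal = trans (sum-cong-≗ {m} {y = λ _ → 0} not-normal) (sum-replicate-zero m)
        where
        not-normal : ∀ b → isNormal (L′ b) ≡ 0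
        not-normal b with L′ b in L-b
        ... | special = refl
        ... | normal = ⊥-elim (no-normal (suc b) L-b)
        ... | fixed = refl
    by-role normal L-zero = begin
      count L p
        ≡⟨ CountNormal.count-normal {L = L} L-zero p ⟩
      sum (λ a → 𝟙[ ¬? (fixed? (L′ a)) ] * (count L′ p′ + count (fixing a L′) p′))
        ≡⟨ sum-cong-≗ deletion-count ⟩
      sum (λ a → (d + dₛ) * isSpecial (L′ a) + (d + dₙ) * isNormal (L′ a))
        ≡⟨ ∑-distrib-+ (λ a → (d + dₛ) * isSpecial (L′ a)) (λ a → (d + dₙ) * isNormal (L′ a)) ⟩
      sum (λ a → (d + dₛ) * isSpecial (L′ a)) + sum (λ a → (d + dₙ) * isNormal (L′ a))
        ≡⟨ cong₂ _+_ (sym (*-distribˡ-sum (d + dₛ) (isSpecial ∘ L′))) (sym (*-distribˡ-sum (d + dₙ) (isNormal ∘ L′))) ⟩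
      (d + dₛ) * S + (d + dₙ) * N
        ≡⟨ solve 5 (λ x y z s n → (x :+ y) :* s :+ (x :+ z) :* n := (s :+ n) :* x :+ s :* y :+ n :* z) refl d dₛ dₙ S N ⟩
      (S + N) * d + S * dₛ + N * dₙ
        ≡⟨ sym (separatedDerangements-suc S N p) ⟩
      separatedDerangements S (suc N) p ∎
      where open ≡-Reasoning

  conjugate : ∀ {m} → (Fin m → Fin m) → Fin m → Fin m
  conjugate f = opposite ∘ f ∘ opposite

  iterate-conjugate : ∀ {m} (f : Fin m → Fin m) k a → opposite (iterate (conjugate f) k a) ≡ iterate f k (opposite a)
  iterate-conjugate f zero a = refl
  iterate-conjugate f (suc k) a = trans (Fin.opposite-involutive _) (cong f (iterate-conjugate f k a))

  admissible-opposite : ∀ {m} ℓ {a y : Fin m} → Admissible ℓ a y → Admissible ℓ (opposite a) (opposite y)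
  admissible-opposite fixed y≡a = cong opposite y≡a
  admissible-opposite special y≢a = y≢a ∘ opposite-injective
  admissible-opposite normal y≢a = y≢a ∘ opposite-injective

  Valid-roles : ∀ {m} {L L′ : Fin m → Role} {p f} → (∀ a → L a ≡ L′ a) → Valid L p f → Valid L′ p f
  Valid-roles L≗L′ v = record
    { injective = Valid.injective v
    ; admissible = λ a → admissible-role (L≗L′ a) (Valid.admissible v a)
    ; separated = λ a b a-special b-special → Valid.separated v a b (trans (L≗L′ a) a-special) (trans (L≗L′ b) b-special)
    ; parity = Valid.parity v
    }

  Valid-conjugate : ∀ {m} {L : Fin m → Role} {p f} → Valid L p f → Valid (L ∘ opposite) p (conjugate f)
  Valid-conjugate {L = L} {f = f} v = record
    { injective = opposite-injective ∘ Valid.injective v ∘ opposite-injective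
    ; admissible = λ a → subst (λ x → Admissible (L (opposite a)) x (conjugate f a)) (Fin.opposite-involutive a)
        (admissible-opposite (L (opposite a)) (Valid.admissible v (opposite a)))
    ; separated = λ a b a-special b-special a≢b (k , reaches) → Valid.separated v (opposite a) (opposite b) a-special b-special
        (a≢b ∘ opposite-injective) (k , trans (sym (iterate-conjugate f k a)) (cong opposite reaches))
    ; parity = trans (cong (_% 2) (inversionCount-opposite f)) (Valid.parity v)
    }

  count-conjugate : ∀ {m} (L : Fin m → Role) p → count L p ≡ count (L ∘ opposite) p
  count-conjugate L p = bijection⇒size≡ (valid-enumeration L p) (valid-enumeration (L ∘ opposite) p) reverse reverse
    (Valid-tabulate ∘ Valid-conjugate)
    (Valid-tabulate ∘ Valid-roles (λ a → cong L (Fin.opposite-involutive a)) ∘ Valid-conjugate)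
    (λ {σ} _ → reverse-involutive σ) (λ {τ} _ → reverse-involutive τ)
    where
    reverse : ∀ {m} → Fun m → Fun m
    reverse σ = tabulate (conjugate (lookup σ))
    reverse-involutive : ∀ {m} (σ : Fun m) → reverse (reverse σ) ≡ σ
    reverse-involutive σ = tabulate-lookup σ λ a →
      trans (cong opposite (lookup∘tabulate (conjugate (lookup σ)) (opposite a)))
        (trans (Fin.opposite-involutive _) (cong (lookup σ) (Fin.opposite-involutive a)))

  specialBelow : ∀ {m} → ℕ → Fin m → Role
  specialBelow r a with toℕ a ℕ.<? r
  ... | yes _ = special
  ... | no _ = normal

  specialBelow-special : ∀ {m} r (a : Fin m) → specialBelow r a ≡ special → toℕ a < r
  specialBelow-special r a eq with toℕ a ℕ.<? r
  ... | yes a<r = a<r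
  specialBelow-special r a () | no _

  specialBelow-normal : ∀ {m} r (a : Fin m) → specialBelow r a ≡ normal → ¬ toℕ a < r
  specialBelow-normal r a eq with toℕ a ℕ.<? r
  specialBelow-normal r a () | yes _
  ... | no a≮r = a≮r

  special-below : ∀ {m} r (a : Fin m) → toℕ a < r → specialBelow r a ≡ special
  special-below r a a<r with toℕ a ℕ.<? r
  ... | yes _ = refl
  ... | no a≮r = ⊥-elim (a≮r a<r)

  specialBelow-moving : ∀ {m} r (a : Fin m) → specialBelow r a ≢ fixed
  specialBelow-moving r a with toℕ a ℕ.<? r
  ... | yes _ = λ ()
  ... | no _ = λ ()

  counted⇒valid : ∀ {m} {r i} {σ : Fun m} → Counted r i σ → Valid (specialBelow r) i (lookup σ)
  counted⇒valid {r = r} {σ = σ} (permutation , derangement , separates , parity) = record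
    { injective = permutation _ _
    ; admissible = λ a → admissible-moving (specialBelow r a) (specialBelow-moving r a) (derangement a)
    ; separated = λ a b a-special b-special a≢b → separates a b (specialBelow-special r a a-special) (specialBelow-special r b b-special) a≢b
        ∘ reachable⇒sameCycle σ (permutation _ _)
    ; parity = trans (cong (_% 2) (sym (inversions≡inversionCount σ))) parity
    }

  valid⇒counted : ∀ {m} {r i} {σ : Fun m} → Valid (specialBelow r) i (lookup σ) → Counted r i σ
  valid⇒counted {r = r} {σ = σ} v =
    (λ _ _ → Valid.injective v) ,
    (λ a → admissible-moves (specialBelow r a) (specialBelow-moving r a) (Valid.admissible v a)) ,
    (λ a b a<r b<r a≢b → Valid.separated v a b (special-below r a a<r) (special-below r b b<r) a≢b ∘ sameCycle⇒reachable σ) ,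
    trans (cong (_% 2) (inversions≡inversionCount σ)) (Valid.parity v)

  D≡count : ∀ i r n → D i r n ≡ count (specialBelow {r + n} r) i
  D≡count i r n = bijection⇒size≡ (filter-enumeration (Counted? r i) (allVecs m m) (allVecs-unique m m) (∈-allVecs m m))
    (valid-enumeration (specialBelow r) i) (λ σ → σ) (λ σ → σ) counted⇒valid valid⇒counted (λ _ → refl) (λ _ → refl)
    where m = r + n

  Ordered-reversed : ∀ {m} r → Ordered (specialBelow {m} r ∘ opposite)
  Ordered-reversed {m} r a b a-special b-normal = ℕ.≰⇒> λ a≤b →
    specialBelow-normal r (opposite b) b-normal (ℕ.≤-<-trans (opposite-≤ a≤b) (specialBelow-special r (opposite a) a-special))
    where
    opposite-≤ : ∀ {x y : Fin m} → toℕ x ℕ.≤ toℕ y → toℕ (opposite y) ℕ.≤ toℕ (opposite x)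
    opposite-≤ {x} {y} x≤y rewrite Fin.opposite-prop x | Fin.opposite-prop y = ℕ.∸-monoʳ-≤ m (ℕ.s≤s x≤y)

  #special-reversed : ∀ r n → #special (specialBelow {r + n} r ∘ opposite) ≡ r
  #special-reversed r n = begin
    sum {r + n} (isSpecial ∘ specialBelow r ∘ opposite) ≡⟨ ∑-reindex (opposite-injective {r + n}) (isSpecial ∘ specialBelow r) ⟩
    sum {r + n} (isSpecial ∘ specialBelow r)            ≡⟨ sum-cong-≗ {r + n} {y = λ a → [ toℕ a < r ]} indicator ⟩
    sum {r + n} (λ a → [ toℕ a < r ])           ≡⟨ ∑-below r (ℕ.m≤m+n r n) ⟩
    r                                           ∎
    where
    open ≡-Reasoning
    indicator : ∀ (a : Fin (r + n)) → isSpecial (specialBelow r a) ≡ [ toℕ a < r ]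
    indicator a with toℕ a ℕ.<? r
    ... | yes a<r = sym (𝟙-yes a<r (toℕ a ℕ.<? r))
    ... | no a≮r = sym (𝟙-no a≮r (toℕ a ℕ.<? r))

  #normal-reversed : ∀ r n → #normal (specialBelow {r + n} r ∘ opposite) ≡ n
  #normal-reversed r n = ℕ.+-cancelˡ-≡ r _ _ (begin
    r + #normal L                                     ≡⟨ cong (_+ #normal L) (sym (#special-reversed r n)) ⟩
    #special L + #normal L                            ≡⟨ sym (∑-distrib-+ (isSpecial ∘ L) (isNormal ∘ L)) ⟩
    sum (λ a → isSpecial (L a) + isNormal (L a))      ≡⟨ sum-cong-≗ {r + n} {y = λ _ → 1} (λ a → one-role (opposite a)) ⟩
    sum {r + n} (λ _ → 1)                             ≡⟨ ∑-one (r + n) ⟩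
    r + n                                             ∎)
    where
    open ≡-Reasoning
    L = specialBelow {r + n} r ∘ opposite
    one-role : ∀ a → isSpecial (specialBelow r a) + isNormal (specialBelow r a) ≡ 1
    one-role a with toℕ a ℕ.<? r
    ... | yes _ = refl
    ... | no _ = refl

  D≡separatedDerangements : ∀ i r n → D i r n ≡ separatedDerangements r n i
  D≡separatedDerangements i r n = begin
    D i r n                                                 ≡⟨ D≡count i r n ⟩
    count L i                                               ≡⟨ count-conjugate L i ⟩
    count (L ∘ opposite) i                                  ≡⟨ count≡separatedDerangements (L ∘ opposite) (Ordered-reversed r) i ⟩
    separatedDerangements (#special (L ∘ opposite)) (#normal (L ∘ opposite)) i
      ≡⟨ cong₂ (λ s n → separatedDerangements s n i) (#special-reversed r n) (#normal-reversed r n) ⟩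
    separatedDerangements r n i                             ∎
    where
    open ≡-Reasoning
    L = specialBelow {r + n} r

module Coefficients where

  open import Data.Nat as ℕ using (ℕ; zero; suc; pred; _∸_; _!; NonZero)
  import Data.Nat.Properties as ℕ
  open import Data.Nat.Properties using (_!≢0)
  import Data.Integer as ℤ
  import Data.Integer.Properties as ℤ
  open import Data.Fin using (Fin; zero; suc; toℕ)
  open import Data.Rational using (ℚ; 0ℚ; 1ℚ; ½; _+_; _*_; -_; _-_; _/_; fromℚᵘ)
  import Data.Rational.Properties as ℚ
  open import Data.Rational.Unnormalised as ℚᵘ using (mkℚᵘ; *≡*) renaming (_+_ to _+ᵘ_; _*_ to _*ᵘ_)
  import Data.Rational.Unnormalised.Properties as ℚᵘ
  open import Data.List using (foldr)
  open import Data.List.Properties using (map-applyUpTo)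
  open import Data.Product using (_×_; _,_; proj₁; proj₂)
  open import Function using (_∘_; id)
  open import Relation.Binary.PropositionalEquality using (_≡_; refl; sym; trans; cong; cong₂; module ≡-Reasoning)
  open import Data.Rational.Solver using (module +-*-Solver)
  open import Data.List using (_∷_; [])
  open import Relation.Nullary.Decidable using (dec⇒maybe)
  open import Level using (0ℓ)
  open import Tactic.RingSolver using () renaming (solve to ring-solve)
  open import Tactic.RingSolver.Core.AlmostCommutativeRing using (AlmostCommutativeRing; fromCommutativeRing)
  open +-*-Solver
  open Counting using (toggle; separatedDerangements; separatedDerangements-suc)

  ℚ-ring : AlmostCommutativeRing 0ℓ 0ℓ
  ℚ-ring = fromCommutativeRing ℚ.+-*-commutativeRing (dec⇒maybe ∘ (0ℚ ℚ.≟_))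

  private
    fromℚᵘ-+ : ∀ x y → fromℚᵘ (x +ᵘ y) ≡ fromℚᵘ x + fromℚᵘ y
    fromℚᵘ-+ x y = trans (ℚ.fromℚᵘ-cong (ℚᵘ.≃-sym (ℚᵘ.≃-trans (ℚ.toℚᵘ-homo-+ (fromℚᵘ x) (fromℚᵘ y))
      (ℚᵘ.+-cong (ℚ.toℚᵘ-fromℚᵘ x) (ℚ.toℚᵘ-fromℚᵘ y))))) (ℚ.fromℚᵘ-toℚᵘ _)

    fromℚᵘ-* : ∀ x y → fromℚᵘ (x *ᵘ y) ≡ fromℚᵘ x * fromℚᵘ y
    fromℚᵘ-* x y = trans (ℚ.fromℚᵘ-cong (ℚᵘ.≃-sym (ℚᵘ.≃-trans (ℚ.toℚᵘ-homo-* (fromℚᵘ x) (fromℚᵘ y))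
      (ℚᵘ.*-cong (ℚ.toℚᵘ-fromℚᵘ x) (ℚ.toℚᵘ-fromℚᵘ y))))) (ℚ.fromℚᵘ-toℚᵘ _)

  fromℕ : ℕ → ℚ
  fromℕ x = ℤ.+ x / 1

  fromℕ-+ : ∀ x y → fromℕ (x ℕ.+ y) ≡ fromℕ x + fromℕ y
  fromℕ-+ x y = trans (ℚ.fromℚᵘ-cong {mkℚᵘ (ℤ.+ (x ℕ.+ y)) 0} {mkℚᵘ (ℤ.+ x) 0 +ᵘ mkℚᵘ (ℤ.+ y) 0} (*≡* numerators))
    (fromℚᵘ-+ (mkℚᵘ (ℤ.+ x) 0) (mkℚᵘ (ℤ.+ y) 0))
    where
    numerators : ℤ.+ (x ℕ.+ y) ℤ.* ℤ.+ 1 ≡ (ℤ.+ x ℤ.* ℤ.+ 1 ℤ.+ ℤ.+ y ℤ.* ℤ.+ 1) ℤ.* ℤ.+ 1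
    numerators = cong (ℤ._* ℤ.+ 1) (trans (ℤ.pos-+ x y) (sym (cong₂ ℤ._+_ (ℤ.*-identityʳ (ℤ.+ x)) (ℤ.*-identityʳ (ℤ.+ y)))))

  fromℕ-* : ∀ x y → fromℕ (x ℕ.* y) ≡ fromℕ x * fromℕ y
  fromℕ-* x y = trans (ℚ.fromℚᵘ-cong {mkℚᵘ (ℤ.+ (x ℕ.* y)) 0} {mkℚᵘ (ℤ.+ x) 0 *ᵘ mkℚᵘ (ℤ.+ y) 0} (*≡* (cong (ℤ._* ℤ.+ 1) (ℤ.pos-* x y))))
    (fromℚᵘ-* (mkℚᵘ (ℤ.+ x) 0) (mkℚᵘ (ℤ.+ y) 0))

  fromℕ-suc : ∀ n → fromℕ (suc n) ≡ fromℕ n + 1ℚ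
  fromℕ-suc n = trans (cong fromℕ (ℕ.+-comm 1 n)) (fromℕ-+ n 1)

  fromℕ/ : ∀ x k .{{_ : NonZero k}} → (ℤ.+ x) / k ≡ fromℕ x * ((ℤ.+ 1) / k)
  fromℕ/ x (suc k) = trans (ℚ.fromℚᵘ-cong {mkℚᵘ (ℤ.+ x) k} {mkℚᵘ (ℤ.+ x) 0 *ᵘ mkℚᵘ (ℤ.+ 1) k} (*≡* numerators))
    (fromℚᵘ-* (mkℚᵘ (ℤ.+ x) 0) (mkℚᵘ (ℤ.+ 1) k))
    where
    numerators : ℤ.+ x ℤ.* ℤ.+ suc (k ℕ.+ 0) ≡ (ℤ.+ x ℤ.* ℤ.+ 1) ℤ.* ℤ.+ suc k
    numerators = trans (cong (λ z → ℤ.+ x ℤ.* ℤ.+ suc z) (ℕ.+-identityʳ k)) (cong (ℤ._* ℤ.+ suc k) (sym (ℤ.*-identityʳ (ℤ.+ x))))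

  /-inverse : ∀ k .{{_ : NonZero k}} → ((ℤ.+ 1) / k) * fromℕ k ≡ 1ℚ
  /-inverse (suc k) = trans (sym (fromℚᵘ-* (mkℚᵘ (ℤ.+ 1) k) (mkℚᵘ (ℤ.+ suc k) 0)))
    (ℚ.fromℚᵘ-cong {mkℚᵘ (ℤ.+ 1) k *ᵘ mkℚᵘ (ℤ.+ suc k) 0} {mkℚᵘ (ℤ.+ 1) 0} (*≡* (cong (λ z → ℤ.+ suc z) denominators)))
    where
    denominators : (k ℕ.+ 0) ℕ.* 1 ≡ k ℕ.* 1 ℕ.+ 0
    denominators = trans (ℕ.*-identityʳ (k ℕ.+ 0)) (cong (ℕ._+ 0) (sym (ℕ.*-identityʳ k)))

  ⊛-suc : ∀ (u w : FPS) n → (u ⊛ w) (suc n) ≡ u 0 * w (suc n) + ((u ∘ suc) ⊛ w) n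
  ⊛-suc u w n = cong (u 0 * w (suc n) +_) (cong (foldr _+_ 0ℚ)
    (trans (map-applyUpTo suc (λ k → u k * w (suc n ∸ k)) (suc n)) (sym (map-applyUpTo id (λ k → u (suc k) * w (n ∸ k)) (suc n)))))

  ⊛-congˡ : ∀ {u u′ : FPS} (w : FPS) → (∀ k → u k ≡ u′ k) → ∀ n → (u ⊛ w) n ≡ (u′ ⊛ w) n
  ⊛-congˡ w u≗u′ zero = cong (λ z → z * w 0 + 0ℚ) (u≗u′ 0)
  ⊛-congˡ {u} {u′} w u≗u′ (suc n) = trans (⊛-suc u w n)
    (trans (cong₂ (λ a b → a * w (suc n) + b) (u≗u′ 0) (⊛-congˡ w (u≗u′ ∘ suc) n)) (sym (⊛-suc u′ w n)))

  zero⊛ : ∀ (w : FPS) n → ((λ _ → 0ℚ) ⊛ w) n ≡ 0ℚ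
  zero⊛ w zero = trans (ℚ.+-identityʳ (0ℚ * w 0)) (ℚ.*-zeroˡ (w 0))
  zero⊛ w (suc n) = trans (⊛-suc (λ _ → 0ℚ) w n)
    (trans (cong (0ℚ * w (suc n) +_) (zero⊛ w n)) (trans (ℚ.+-identityʳ (0ℚ * w (suc n))) (ℚ.*-zeroˡ (w (suc n)))))

  one⊛ : ∀ (w : FPS) n → (one ⊛ w) n ≡ w n
  one⊛ w zero = trans (ℚ.+-identityʳ (1ℚ * w 0)) (ℚ.*-identityˡ (w 0))
  one⊛ w (suc n) = trans (⊛-suc one w n)
    (trans (cong (1ℚ * w (suc n) +_) (zero⊛ w n)) (trans (ℚ.+-identityʳ (1ℚ * w (suc n))) (ℚ.*-identityˡ (w (suc n)))))

  ⊛one : ∀ (u : FPS) n → (u ⊛ one) n ≡ u n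
  ⊛one u zero = trans (ℚ.+-identityʳ (u 0 * 1ℚ)) (ℚ.*-identityʳ (u 0))
  ⊛one u (suc n) = trans (⊛-suc u one n)
    (trans (cong (u 0 * 0ℚ +_) (⊛one (u ∘ suc) n)) (trans (cong (_+ u (suc n)) (ℚ.*-zeroʳ (u 0))) (ℚ.+-identityˡ (u (suc n)))))

  shift : FPS → FPS
  shift u zero = 0ℚ
  shift u (suc n) = u n

  shift⊛ : ∀ (u w : FPS) n → (shift u ⊛ w) n ≡ shift (u ⊛ w) n
  shift⊛ u w zero = trans (ℚ.+-identityʳ (0ℚ * w 0)) (ℚ.*-zeroˡ (w 0))
  shift⊛ u w (suc n) =
    trans (⊛-suc (shift u) w n) (trans (cong (_+ (u ⊛ w) n) (ℚ.*-zeroˡ (w (suc n)))) (ℚ.+-identityˡ ((u ⊛ w) n)))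

  X⊛ : ∀ (w : FPS) n → (X ⊛ w) n ≡ shift w n
  X⊛ w zero = trans (ℚ.+-identityʳ (0ℚ * w 0)) (ℚ.*-zeroˡ (w 0))
  X⊛ w (suc n) = trans (⊛-suc X w n) (trans (cong (_+ ((X ∘ suc) ⊛ w) n) (ℚ.*-zeroˡ (w (suc n))))
    (trans (ℚ.+-identityˡ (((X ∘ suc) ⊛ w) n)) (trans (⊛-congˡ w X-suc n) (one⊛ w n))))
    where
    X-suc : ∀ k → X (suc k) ≡ one k
    X-suc zero = refl
    X-suc (suc k) = refl

  scale⊛ : ∀ (c : ℚ) (u w : FPS) n → ((λ k → c * u k) ⊛ w) n ≡ c * (u ⊛ w) n
  scale⊛ c u w zero = solve 3 (λ c a b → c :* a :* b :+ con 0ℚ := c :* (a :* b :+ con 0ℚ)) refl c (u 0) (w 0)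
  scale⊛ c u w (suc n) = trans (⊛-suc (λ k → c * u k) w n) (trans (cong (c * u 0 * w (suc n) +_) (scale⊛ c (u ∘ suc) w n))
    (trans (solve 4 (λ c a b d → c :* a :* b :+ c :* d := c :* (a :* b :+ d)) refl c (u 0) (w (suc n)) (((u ∘ suc) ⊛ w) n))
      (cong (c *_) (sym (⊛-suc u w n)))))

  ⊛-split-right : ∀ (u w v w′ : FPS) → (∀ j → w (suc j) ≡ v j + w′ (suc j)) → w 0 ≡ w′ 0
    → ∀ n → (u ⊛ w) (suc n) ≡ (u ⊛ v) n + (u ⊛ w′) (suc n)
  ⊛-split-right u w v w′ w-suc w-zero zero =
    trans (⊛-suc u w 0) (trans (cong₂ (λ a b → u 0 * a + (u 1 * b + 0ℚ)) (w-suc 0) w-zero)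
      (trans (solve 5 (λ u0 u1 v0 w1 w0 →
                 u0 :* (v0 :+ w1) :+ (u1 :* w0 :+ con 0ℚ) := (u0 :* v0 :+ con 0ℚ) :+ (u0 :* w1 :+ (u1 :* w0 :+ con 0ℚ)))
               refl (u 0) (u 1) (v 0) (w′ 1) (w′ 0))
        (cong ((u 0 * v 0 + 0ℚ) +_) (sym (⊛-suc u w′ 0)))))
  ⊛-split-right u w v w′ w-suc w-zero (suc n) =
    trans (⊛-suc u w (suc n))
      (trans (cong₂ (λ a b → u 0 * a + b) (w-suc (suc n)) (⊛-split-right (u ∘ suc) w v w′ w-suc w-zero n))
      (trans (solve 5 (λ u0 v1 w2 p q → u0 :* (v1 :+ w2) :+ (p :+ q) := (u0 :* v1 :+ p) :+ (u0 :* w2 :+ q))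
               refl (u 0) (v (suc n)) (w′ (suc (suc n))) (((u ∘ suc) ⊛ v) n) (((u ∘ suc) ⊛ w′) (suc n)))
        (cong₂ _+_ (sym (⊛-suc u v n)) (sym (⊛-suc u w′ (suc n))))))

  ifZero : ℕ → ℚ
  ifZero zero = 1ℚ
  ifZero (suc _) = 0ℚ

  xPowExp : ℕ → FPS
  xPowExp s = pow X s ⊛ expNeg

  xPowExp-suc : ∀ s n → xPowExp (suc s) n ≡ shift (xPowExp s) n
  xPowExp-suc s n = trans (⊛-congˡ expNeg (X⊛ (pow X s)) n) (shift⊛ (pow X s) expNeg n)

  xPowExp-zero : ∀ n → xPowExp 0 n ≡ expNeg n
  xPowExp-zero n = one⊛ expNeg n

  xPowExp-constant : ∀ s → xPowExp s 0 ≡ ifZero s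
  xPowExp-constant zero = xPowExp-zero 0
  xPowExp-constant (suc s) = xPowExp-suc s 0

  geometric : ℕ → FPS
  geometric k = pow invOneMinusX k

  geometric-constant : ∀ k → geometric k 0 ≡ 1ℚ
  geometric-constant zero = refl
  geometric-constant (suc k) =
    trans (ℚ.+-identityʳ (1ℚ * geometric k 0)) (trans (ℚ.*-identityˡ (geometric k 0)) (geometric-constant k))

  geometric-suc : ∀ k j → geometric (suc k) (suc j) ≡ geometric (suc k) j + geometric k (suc j)
  geometric-suc k j = trans (⊛-suc invOneMinusX (geometric k) j)
    (solve 2 (λ a b → con 1ℚ :* a :+ b := b :+ a) refl (geometric k (suc j)) (geometric (suc k) j))

  -- total r and signed r are the coefficients of the two summands of rhs: the EGFs of all separated
  -- derangements and of their signed count; opaque, so that the algebra below never unfolds them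
  opaque
    total : ℕ → ℕ → ℚ
    total s n = (pow X s ⊛ expNeg ⊛ pow invOneMinusX (suc s)) n

    total-constant : ∀ s → total s 0 ≡ ifZero s
    total-constant s = trans (ℚ.+-identityʳ (xPowExp s 0 * geometric (suc s) 0))
      (trans (cong₂ _*_ (xPowExp-constant s) (geometric-constant (suc s))) (ℚ.*-identityʳ (ifZero s)))

    total-suc : ∀ s n → total (suc s) (suc n) ≡ total (suc s) n + total s n
    total-suc s n = trans (⊛-congˡ (geometric (suc (suc s))) (xPowExp-suc s) (suc n))
      (trans (shift⊛ (xPowExp s) (geometric (suc (suc s))) (suc n))
        (trans (split n) (cong (_+ total s n) (sym (trans (⊛-congˡ (geometric (suc (suc s))) (xPowExp-suc s) n)
          (shift⊛ (xPowExp s) (geometric (suc (suc s))) n))))))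
      where
      split : ∀ n → (xPowExp s ⊛ geometric (suc (suc s))) n
                  ≡ shift (xPowExp s ⊛ geometric (suc (suc s))) n + (xPowExp s ⊛ geometric (suc s)) n
      split zero = trans (cong (λ z → xPowExp s 0 * z + 0ℚ) (trans (geometric-constant (suc (suc s))) (sym (geometric-constant (suc s)))))
        (sym (ℚ.+-identityˡ ((xPowExp s ⊛ geometric (suc s)) 0)))
      split (suc m) = ⊛-split-right (xPowExp s) (geometric (suc (suc s))) (geometric (suc (suc s))) (geometric (suc s))
        (geometric-suc (suc s)) (trans (geometric-constant (suc (suc s))) (sym (geometric-constant (suc s)))) m

    total-zero-suc : ∀ n → total 0 (suc n) ≡ total 0 n + expNeg (suc n)
    total-zero-suc n = trans (⊛-congˡ (geometric 1) xPowExp-zero (suc n))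
      (trans (⊛-split-right expNeg (geometric 1) (geometric 1) (geometric 0) (geometric-suc 0) (geometric-constant 1) n)
        (cong₂ _+_ (sym (⊛-congˡ (geometric 1) xPowExp-zero n)) (⊛one expNeg (suc n))))

    total-def : ∀ s n → total s n ≡ (pow X s ⊛ expNeg ⊛ pow invOneMinusX (suc s)) n
    total-def s n = refl

  signedFactor : ℕ → FPS
  signedFactor s = onePlusXPow1-r s

  pow-invOnePlusX-constant : ∀ t → pow invOnePlusX t 0 ≡ 1ℚ
  pow-invOnePlusX-constant zero = refl
  pow-invOnePlusX-constant (suc t) =
    trans (ℚ.+-identityʳ (1ℚ * pow invOnePlusX t 0)) (trans (ℚ.*-identityˡ _) (pow-invOnePlusX-constant t))

  signedFactor-constant : ∀ s → signedFactor s 0 ≡ 1ℚ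
  signedFactor-constant zero = refl
  signedFactor-constant (suc t) = pow-invOnePlusX-constant t

  neg⊛ : ∀ (u w : FPS) n → ((λ k → - u k) ⊛ w) n ≡ - (u ⊛ w) n
  neg⊛ u w n = trans (⊛-congˡ w (λ k → solve 1 (λ x → :- x := con (- 1ℚ) :* x) refl (u k)) n)
    (trans (scale⊛ (- 1ℚ) u w n) (solve 1 (λ x → con (- 1ℚ) :* x := :- x) refl ((u ⊛ w) n)))

  signedFactor-suc : ∀ s j → signedFactor s (suc j) ≡ signedFactor (suc s) j + signedFactor (suc s) (suc j)
  signedFactor-suc zero zero = refl
  signedFactor-suc zero (suc j) = refl
  signedFactor-suc (suc t) j = sym (trans (cong ((invOnePlusX ⊛ W) j +_) (⊛-suc invOnePlusX W j))
     (trans (cong (λ z → (invOnePlusX ⊛ W) j + (1ℚ * W (suc j) + z)) (neg⊛ invOnePlusX W j))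
       (solve 2 (λ p w → p :+ (con 1ℚ :* w :+ :- p) := w) refl ((invOnePlusX ⊛ W) j) (W (suc j)))))
    where
    W = pow invOnePlusX t

  opaque
    signed : ℕ → ℕ → ℚ
    signed s n = (pow X s ⊛ expNeg ⊛ onePlusXPow1-r s) n

    signed-constant : ∀ s → signed s 0 ≡ ifZero s
    signed-constant s = trans (ℚ.+-identityʳ (xPowExp s 0 * signedFactor s 0))
      (trans (cong₂ _*_ (xPowExp-constant s) (signedFactor-constant s)) (ℚ.*-identityʳ (ifZero s)))

    signed-suc : ∀ s n → signed (suc s) (suc n) ≡ signed s n - signed (suc s) n
    signed-suc s n = trans (⊛-congˡ (signedFactor (suc s)) (xPowExp-suc s) (suc n))
      (trans (shift⊛ (xPowExp s) (signedFactor (suc s)) (suc n))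
        (trans (split n) (cong (λ z → signed s n - z) (sym (trans (⊛-congˡ (signedFactor (suc s)) (xPowExp-suc s) n)
          (shift⊛ (xPowExp s) (signedFactor (suc s)) n))))))
      where
      split : ∀ n → (xPowExp s ⊛ signedFactor (suc s)) n ≡ (xPowExp s ⊛ signedFactor s) n - shift (xPowExp s ⊛ signedFactor (suc s)) n
      split zero = trans (cong (λ z → xPowExp s 0 * z + 0ℚ) (trans (signedFactor-constant (suc s)) (sym (signedFactor-constant s))))
        (solve 1 (λ x → x := x :- con 0ℚ) refl ((xPowExp s ⊛ signedFactor s) 0))
      split (suc m) = trans (solve 2 (λ x y → x := (y :+ x) :- y) refl ((xPowExp s ⊛ signedFactor (suc s)) (suc m)) ((xPowExp s ⊛ signedFactor (suc s)) m))
        (cong (λ z → z - (xPowExp s ⊛ signedFactor (suc s)) m) (sym (⊛-split-right (xPowExp s) (signedFactor s) (signedFactor (suc s))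
          (signedFactor (suc s)) (signedFactor-suc s) (trans (signedFactor-constant s) (sym (signedFactor-constant (suc s)))) m)))

    signed-zero-suc : ∀ n → signed 0 (suc n) ≡ expNeg (suc n) + expNeg n
    signed-zero-suc n = trans (⊛-congˡ onePlusX xPowExp-zero (suc n))
      (trans (⊛-split-right expNeg onePlusX one one (λ { zero → refl ; (suc j) → refl }) refl n)
        (trans (cong₂ _+_ (⊛one expNeg n) (⊛one expNeg (suc n))) (ℚ.+-comm (expNeg n) _)))

    signed-def : ∀ s n → signed s n ≡ (pow X s ⊛ expNeg ⊛ onePlusXPow1-r s) n
    signed-def s n = refl


  invFactorial : ℕ → ℚ
  invFactorial n = ((ℤ.+ 1) / (n !)) {{n !≢0}}

  invFactorial-inverse : ∀ n → invFactorial n * fromℕ (n !) ≡ 1ℚ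
  invFactorial-inverse n = /-inverse (n !) {{n !≢0}}

  inverse-unique : ∀ {x y N : ℚ} → x * N ≡ 1ℚ → y * N ≡ 1ℚ → x ≡ y
  inverse-unique {x} {y} {N} hx hy = begin
      x                 ≡⟨ sym (ℚ.*-identityʳ x) ⟩
      x * 1ℚ            ≡⟨ cong (x *_) (sym hy) ⟩
      x * (y * N)       ≡⟨ ring-solve (x ∷ y ∷ N ∷ []) ℚ-ring ⟩
      (x * N) * y       ≡⟨ cong (_* y) hx ⟩
      1ℚ * y            ≡⟨ ℚ.*-identityˡ y ⟩
      y ∎
    where open ≡-Reasoning

  invFactorial-suc : ∀ n → invFactorial (suc n) * fromℕ (suc n) ≡ invFactorial n
  invFactorial-suc n = inverse-unique {N = fromℕ (n !)} (trans (ℚ.*-assoc (invFactorial (suc n)) (fromℕ (suc n)) (fromℕ (n !)))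
                      (trans (cong (invFactorial (suc n) *_) (sym (fromℕ-* (suc n) (n !)))) (invFactorial-inverse (suc n))))
                    (invFactorial-inverse n)

  expNeg-suc : ∀ n → fromℕ (suc n) * expNeg (suc n) ≡ - expNeg n
  expNeg-suc n = trans (solve 3 (λ a s i → a :* ((:- s) :* i) := :- (s :* (i :* a))) refl (fromℕ (suc n)) (sgn n) (invFactorial (suc n)))
    (cong (λ z → - (sgn n * z)) (invFactorial-suc n))

  ≡-from-difference : ∀ {X Y : ℚ} → X - Y ≡ 0ℚ → X ≡ Y
  ≡-from-difference {X} {Y} e = begin
    X            ≡⟨ ring-solve (X ∷ Y ∷ []) ℚ-ring ⟩
    (X - Y) + Y  ≡⟨ cong (_+ Y) e ⟩
    0ℚ + Y       ≡⟨ ℚ.+-identityˡ Y ⟩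
    Y            ∎
    where open ≡-Reasoning

  linear-combination₁ : ∀ {X Y L₁ R₁ : ℚ} → L₁ ≡ R₁ → (c₁ : ℚ) → X - Y ≡ c₁ * (L₁ - R₁) → X ≡ Y
  linear-combination₁ {R₁ = R₁} refl c₁ e = ≡-from-difference (trans e (ring-solve (c₁ ∷ R₁ ∷ []) ℚ-ring))

  linear-combination₂ : ∀ {X Y L₁ R₁ L₂ R₂ : ℚ} → L₁ ≡ R₁ → L₂ ≡ R₂ → (c₁ c₂ : ℚ)
    → X - Y ≡ c₁ * (L₁ - R₁) + c₂ * (L₂ - R₂) → X ≡ Y
  linear-combination₂ {R₁ = R₁} {R₂ = R₂} refl refl c₁ c₂ e =
    ≡-from-difference (trans e (ring-solve (c₁ ∷ c₂ ∷ R₁ ∷ R₂ ∷ []) ℚ-ring))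

  linear-combination₃ : ∀ {X Y L₁ R₁ L₂ R₂ L₃ R₃ : ℚ} → L₁ ≡ R₁ → L₂ ≡ R₂ → L₃ ≡ R₃ → (c₁ c₂ c₃ : ℚ)
    → X - Y ≡ c₁ * (L₁ - R₁) + c₂ * (L₂ - R₂) + c₃ * (L₃ - R₃) → X ≡ Y
  linear-combination₃ {R₁ = R₁} {R₂ = R₂} {R₃ = R₃} refl refl refl c₁ c₂ c₃ e =
    ≡-from-difference (trans e (ring-solve (c₁ ∷ c₂ ∷ c₃ ∷ R₁ ∷ R₂ ∷ R₃ ∷ []) ℚ-ring))


  -- In each *-step lemma the sequence values and casts are variables: the hypotheses stating how they
  -- are related are matched away by refl, and the goal is a linear combination of the remaining ones.
  total-raise-step₀ : ∀ (M1 M2 a1 a0m a01 a02 e1 e2 a1s : ℚ) → a1s ≡ a1 + a0m → a01 ≡ a0m + e1 → a02 ≡ a01 + e2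
    → M2 ≡ M1 + 1ℚ → 1ℚ * a1 ≡ (M1 - 0ℚ) * a01 - 0ℚ * a0m → M2 * e2 ≡ - e1 → 1ℚ * a1s ≡ (M2 - 0ℚ) * a02 - 0ℚ * a01
  total-raise-step₀ M1 _ a1 a0m _ _ e1 e2 _ refl refl refl refl h4 h5 =
    linear-combination₂ h4 h5 1ℚ (- 1ℚ) (ring-solve (M1 ∷ a1 ∷ a0m ∷ e1 ∷ e2 ∷ []) ℚ-ring)

  total-raise-step : ∀ (Tp T T1 M1 M2 a1 a2 a3 a4 a5 a6 a7 : ℚ) → T ≡ Tp + 1ℚ → T1 ≡ T + 1ℚ → M2 ≡ M1 + 1ℚ
    → a6 ≡ a1 + a2 → a3 ≡ a2 + a4 → a7 ≡ a3 + a5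
    → T1 * a1 ≡ (M1 - T) * a3 - T * a2 → T * a2 ≡ (M1 - Tp) * a5 - Tp * a4
    → T1 * a6 ≡ (M2 - T) * a7 - T * a3
  total-raise-step Tp _ _ M1 _ a1 a2 _ a4 a5 _ _ refl refl refl refl refl refl h4 h5 =
    linear-combination₂ h4 h5 1ℚ 1ℚ (ring-solve (Tp ∷ M1 ∷ a1 ∷ a2 ∷ a4 ∷ a5 ∷ []) ℚ-ring)

  -- the coefficients of (t + 1) G (t + 1) = G t ′ − t (1/x + 1) G t, where G t = x^t e^{−x} (1 − x)^{−(t+1)}
  total-raise : ∀ t m → fromℕ (suc t) * total (suc t) m ≡ (fromℕ (suc m) - fromℕ t) * total t (suc m) - fromℕ t * total t m
  total-raise zero zero rewrite total-zero-suc 0 | total-constant 1 | total-constant 0 = refl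
  total-raise (suc zero) zero rewrite total-suc 0 0 | total-constant 2 | total-constant 1 | total-constant 0 = refl
  total-raise (suc (suc t)) zero
    rewrite total-suc (suc t) 0 | total-constant (3 ℕ.+ t) | total-constant (2 ℕ.+ t) | total-constant (suc t) =
    solve 2 (λ u v → u :* con 0ℚ := (con 1ℚ :- v) :* (con 0ℚ :+ con 0ℚ) :- v :* con 0ℚ) refl (fromℕ (3 ℕ.+ t)) (fromℕ (2 ℕ.+ t))
  total-raise zero (suc m) = total-raise-step₀ (fromℕ (suc m)) (fromℕ (2 ℕ.+ m))
    (total 1 m) (total 0 m) (total 0 (suc m)) (total 0 (2 ℕ.+ m)) (expNeg (suc m)) (expNeg (2 ℕ.+ m)) (total 1 (suc m))
    (total-suc 0 m) (total-zero-suc m) (total-zero-suc (suc m)) (fromℕ-suc (suc m)) (total-raise 0 m) (expNeg-suc (suc m))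
  total-raise (suc t) (suc m) = total-raise-step (fromℕ t) (fromℕ (suc t)) (fromℕ (2 ℕ.+ t)) (fromℕ (suc m)) (fromℕ (2 ℕ.+ m))
    (total (2 ℕ.+ t) m) (total (suc t) m) (total (suc t) (suc m)) (total t m) (total t (suc m))
    (total (2 ℕ.+ t) (suc m)) (total (suc t) (2 ℕ.+ m))
    (fromℕ-suc t) (fromℕ-suc (suc t)) (fromℕ-suc (suc m)) (total-suc (suc t) m) (total-suc t m) (total-suc t (suc m))
    (total-raise (suc t) m) (total-raise t m)

  total-recurrence-step₀ : ∀ (M1 M2 a0m a01 a02 e1 e2 : ℚ) → M2 ≡ M1 + 1ℚ → a01 ≡ a0m + e1 → a02 ≡ a01 + e2
    → M2 * e2 ≡ - e1 → M2 * a02 ≡ M1 * a01 + 0ℚ * a01 + a0m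
  total-recurrence-step₀ M1 _ a0m _ _ e1 e2 refl refl refl hE =
    linear-combination₁ hE 1ℚ (ring-solve (M1 ∷ a0m ∷ e1 ∷ e2 ∷ []) ℚ-ring)

  total-recurrence-step : ∀ (T R M1 M2 RM Arm Atm At1 Ar1 Ar2 : ℚ) → R ≡ T + 1ℚ → M2 ≡ M1 + 1ℚ → RM ≡ R + M1
    → Ar1 ≡ Arm + Atm → Ar2 ≡ Ar1 + At1 → R * Arm ≡ (M1 - T) * At1 - T * Atm
    → M2 * Ar2 ≡ RM * Ar1 + R * At1 + Arm
  total-recurrence-step T _ M1 _ _ Arm Atm At1 _ _ refl refl refl refl refl hK =
    linear-combination₁ hK (- 1ℚ) (ring-solve (T ∷ M1 ∷ Arm ∷ Atm ∷ At1 ∷ []) ℚ-ring)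

  -- the coefficients of (1 − x) G r ′ = (r + x) G r + r G (r − 1)
  total-recurrence : ∀ r n
    → fromℕ (suc n) * total r (suc n) ≡ fromℕ (r ℕ.+ n) * total r n + fromℕ r * total (pred r) n + shift (total r) n
  total-recurrence zero zero rewrite total-zero-suc 0 | total-constant 0 = refl
  total-recurrence (suc zero) zero rewrite total-suc 0 0 | total-constant 1 | total-constant 0 = refl
  total-recurrence (suc (suc t)) zero rewrite total-suc (suc t) 0 | total-constant (2 ℕ.+ t) | total-constant (suc t) =
    solve 2 (λ u v → con 1ℚ :* (con 0ℚ :+ con 0ℚ) := u :* con 0ℚ :+ v :* con 0ℚ :+ con 0ℚ) refl (fromℕ (2 ℕ.+ t ℕ.+ 0)) (fromℕ (2 ℕ.+ t))
  total-recurrence zero (suc m) = total-recurrence-step₀ (fromℕ (suc m)) (fromℕ (2 ℕ.+ m))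
    (total 0 m) (total 0 (suc m)) (total 0 (2 ℕ.+ m)) (expNeg (suc m)) (expNeg (2 ℕ.+ m))
    (fromℕ-suc (suc m)) (total-zero-suc m) (total-zero-suc (suc m)) (expNeg-suc (suc m))
  total-recurrence (suc t) (suc m) = total-recurrence-step (fromℕ t) (fromℕ (suc t)) (fromℕ (suc m)) (fromℕ (2 ℕ.+ m))
    (fromℕ (suc t ℕ.+ suc m)) (total (suc t) m) (total t m) (total t (suc m)) (total (suc t) (suc m)) (total (suc t) (2 ℕ.+ m))
    (fromℕ-suc t) (fromℕ-suc (suc m)) (fromℕ-+ (suc t) (suc m)) (total-suc t m) (total-suc t (suc m)) (total-raise t m)

  signed-zero-recurrence-step : ∀ (K1 M1 M2 ea eb ec ed x y z : ℚ) → M1 ≡ K1 + 1ℚ → M2 ≡ M1 + 1ℚ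
    → x ≡ ed + ec → y ≡ ec + eb → z ≡ eb + ea
    → M2 * ed ≡ - ec → M1 * ec ≡ - eb → K1 * eb ≡ - ea → M2 * x ≡ - (M1 * y) + 0ℚ * y - z
  signed-zero-recurrence-step K1 _ _ ea eb ec ed _ _ _ refl refl refl refl refl h1 h2 h3 =
    linear-combination₃ h1 h2 h3 1ℚ (1ℚ + 1ℚ) 1ℚ (ring-solve (K1 ∷ ea ∷ eb ∷ ec ∷ ed ∷ []) ℚ-ring)

  signed-zero-recurrence : ∀ m → fromℕ (2 ℕ.+ m) * signed 0 (2 ℕ.+ m)
    ≡ - (fromℕ (suc m) * signed 0 (suc m)) + fromℕ 0 * signed 0 (suc m) - signed 0 m
  signed-zero-recurrence zero rewrite signed-zero-suc 1 | signed-zero-suc 0 | signed-constant 0 = refl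
  signed-zero-recurrence (suc k) = signed-zero-recurrence-step (fromℕ (suc k)) (fromℕ (2 ℕ.+ k)) (fromℕ (3 ℕ.+ k))
    (expNeg k) (expNeg (suc k)) (expNeg (2 ℕ.+ k)) (expNeg (3 ℕ.+ k)) (signed 0 (3 ℕ.+ k)) (signed 0 (2 ℕ.+ k)) (signed 0 (suc k))
    (fromℕ-suc (suc k)) (fromℕ-suc (2 ℕ.+ k)) (signed-zero-suc (2 ℕ.+ k)) (signed-zero-suc (suc k)) (signed-zero-suc k)
    (expNeg-suc (2 ℕ.+ k)) (expNeg-suc (suc k)) (expNeg-suc k)

  signed-raise-step₀ : ∀ (M1 M2 B1m B0m B01 B02 B1s : ℚ) → B1s ≡ B0m - B1m → M2 ≡ M1 + 1ℚ
    → (0ℚ - 1ℚ) * B1m ≡ 0ℚ * B0m + (M1 - 0ℚ) * B01 → M2 * B02 ≡ - (M1 * B01) + 0ℚ * B01 - B0m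
    → (0ℚ - 1ℚ) * B1s ≡ 0ℚ * B01 + (M2 - 0ℚ) * B02
  signed-raise-step₀ M1 _ B1m B0m B01 B02 _ refl refl h1 h2 =
    linear-combination₂ h1 h2 (- 1ℚ) (- 1ℚ) (ring-solve (M1 ∷ B1m ∷ B0m ∷ B01 ∷ B02 ∷ []) ℚ-ring)

  signed-raise-step : ∀ (Tp T M1 M2 b1 b2 b3 b4 b5 b6 b7 : ℚ) → T ≡ Tp + 1ℚ → M2 ≡ M1 + 1ℚ
    → b3 ≡ b4 - b2 → b6 ≡ b2 - b1 → b7 ≡ b5 - b3
    → (T - 1ℚ) * b1 ≡ T * b2 + (M1 - T) * b3 → (Tp - 1ℚ) * b2 ≡ Tp * b4 + (M1 - Tp) * b5
    → (T - 1ℚ) * b6 ≡ T * b3 + (M2 - T) * b7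
  signed-raise-step Tp _ M1 _ b1 b2 _ b4 b5 _ _ refl refl refl refl refl h4 h5 =
    linear-combination₂ h4 h5 (- 1ℚ) 1ℚ (ring-solve (Tp ∷ M1 ∷ b1 ∷ b2 ∷ b4 ∷ b5 ∷ []) ℚ-ring)

  -- the coefficients of (t − 1) H (t + 1) = H t ′ + t (1 − 1/x) H t, where H t = x^t e^{−x} (1 + x)^{1−t}
  signed-raise : ∀ t m
    → (fromℕ t - 1ℚ) * signed (suc t) m ≡ fromℕ t * signed t m + (fromℕ (suc m) - fromℕ t) * signed t (suc m)
  signed-raise zero zero rewrite signed-zero-suc 0 | signed-constant 1 | signed-constant 0 = refl
  signed-raise (suc zero) zero rewrite signed-suc 0 0 | signed-constant 2 | signed-constant 1 | signed-constant 0 = refl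
  signed-raise (suc (suc t)) zero
    rewrite signed-suc (suc t) 0 | signed-constant (3 ℕ.+ t) | signed-constant (2 ℕ.+ t) | signed-constant (suc t) =
    solve 1 (λ v → (v :- con 1ℚ) :* con 0ℚ := v :* con 0ℚ :+ (con 1ℚ :- v) :* (con 0ℚ :- con 0ℚ)) refl (fromℕ (2 ℕ.+ t))
  signed-raise zero (suc m) = signed-raise-step₀ (fromℕ (suc m)) (fromℕ (2 ℕ.+ m))
    (signed 1 m) (signed 0 m) (signed 0 (suc m)) (signed 0 (2 ℕ.+ m)) (signed 1 (suc m))
    (signed-suc 0 m) (fromℕ-suc (suc m)) (signed-raise 0 m) (signed-zero-recurrence m)
  signed-raise (suc t) (suc m) = signed-raise-step (fromℕ t) (fromℕ (suc t)) (fromℕ (suc m)) (fromℕ (2 ℕ.+ m))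
    (signed (2 ℕ.+ t) m) (signed (suc t) m) (signed (suc t) (suc m)) (signed t m) (signed t (suc m))
    (signed (2 ℕ.+ t) (suc m)) (signed (suc t) (2 ℕ.+ m))
    (fromℕ-suc t) (fromℕ-suc (suc m)) (signed-suc t m) (signed-suc (suc t) m) (signed-suc t (suc m))
    (signed-raise (suc t) m) (signed-raise t m)

  signed-recurrence-step : ∀ (T R M1 M2 RM Btm Brm Bt1 Br1 Br2 : ℚ) → R ≡ T + 1ℚ → M2 ≡ M1 + 1ℚ → RM ≡ R + M1
    → Br1 ≡ Btm - Brm → Br2 ≡ Bt1 - Br1 → (T - 1ℚ) * Brm ≡ T * Btm + (M1 - T) * Bt1
    → M2 * Br2 ≡ - (RM * Br1) + R * Bt1 - Brm
  signed-recurrence-step T _ M1 _ _ Btm Brm Bt1 _ _ refl refl refl refl refl hK =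
    linear-combination₁ hK (- 1ℚ) (ring-solve (T ∷ M1 ∷ Btm ∷ Brm ∷ Bt1 ∷ []) ℚ-ring)

  -- the coefficients of (1 + x) H r ′ = r H (r − 1) − (r + x) H r
  signed-recurrence : ∀ r n
    → fromℕ (suc n) * signed r (suc n) ≡ - (fromℕ (r ℕ.+ n) * signed r n) + fromℕ r * signed (pred r) n - shift (signed r) n
  signed-recurrence zero zero rewrite signed-zero-suc 0 | signed-constant 0 = refl
  signed-recurrence (suc zero) zero rewrite signed-suc 0 0 | signed-constant 1 | signed-constant 0 = refl
  signed-recurrence (suc (suc t)) zero rewrite signed-suc (suc t) 0 | signed-constant (2 ℕ.+ t) | signed-constant (suc t) =
    solve 2 (λ u v → con 1ℚ :* (con 0ℚ :- con 0ℚ) := :- (u :* con 0ℚ) :+ v :* con 0ℚ :- con 0ℚ) refl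
      (fromℕ (2 ℕ.+ t ℕ.+ 0)) (fromℕ (2 ℕ.+ t))
  signed-recurrence zero (suc m) = signed-zero-recurrence m
  signed-recurrence (suc t) (suc m) = signed-recurrence-step (fromℕ t) (fromℕ (suc t)) (fromℕ (suc m)) (fromℕ (2 ℕ.+ m))
    (fromℕ (suc t ℕ.+ suc m)) (signed t m) (signed (suc t) m) (signed t (suc m)) (signed (suc t) (suc m)) (signed (suc t) (2 ℕ.+ m))
    (fromℕ-suc t) (fromℕ-suc (suc m)) (fromℕ-+ (suc t) (suc m)) (signed-suc t m) (signed-suc t (suc m)) (signed-raise t m)

  neg-involutive : ∀ x → - (- x) ≡ x
  neg-involutive x = ring-solve (x ∷ []) ℚ-ring

  sgn-toggle : ∀ k i → sgn (k ℕ.+ toℕ (toggle i)) ≡ - sgn (k ℕ.+ toℕ i)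
  sgn-toggle k zero = trans (cong sgn (ℕ.+-comm k 1)) (cong (λ z → - sgn z) (sym (ℕ.+-identityʳ k)))
  sgn-toggle k (suc zero) =
    trans (cong sgn (ℕ.+-identityʳ k)) (sym (trans (cong (λ z → - sgn z) (ℕ.+-comm k 1)) (neg-involutive (sgn k))))

  sgn-pred : ∀ r i → fromℕ r * sgn (pred r ℕ.+ toℕ (toggle i)) ≡ fromℕ r * sgn (r ℕ.+ toℕ i)
  sgn-pred zero i = trans (ℚ.*-zeroˡ (sgn (toℕ (toggle i)))) (sym (ℚ.*-zeroˡ (sgn (toℕ i))))
  sgn-pred (suc t) zero = cong (λ z → fromℕ (suc t) * sgn z) (trans (ℕ.+-comm t 1) (cong suc (sym (ℕ.+-identityʳ t))))
  sgn-pred (suc t) (suc zero) = cong (fromℕ (suc t) *_) (trans (cong sgn (ℕ.+-identityʳ t))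
    (sym (trans (cong (λ z → - sgn z) (ℕ.+-comm t 1)) (neg-involutive (sgn t)))))

  rhsCoefficient : Fin 2 → ℕ → ℕ → ℚ
  rhsCoefficient i r n = ½ * (total r n + sgn (r ℕ.+ toℕ i) * signed r n)

  rhs≡rhsCoefficient : ∀ i r n → rhs i r n ≡ rhsCoefficient i r n
  rhs≡rhsCoefficient i r n = sym (cong₂ (λ a b → ½ * (a + sgn (r ℕ.+ toℕ i) * b)) (total-def r n) (signed-def r n))

  shift-rhsCoefficient : ∀ i r n
    → shift (rhsCoefficient (toggle i) r) n ≡ ½ * (shift (total r) n + sgn (r ℕ.+ toℕ (toggle i)) * shift (signed r) n)
  shift-rhsCoefficient i r zero = solve 1 (λ s → con 0ℚ := con ½ :* (con 0ℚ :+ s :* con 0ℚ)) refl (sgn (r ℕ.+ toℕ (toggle i)))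
  shift-rhsCoefficient i r (suc k) = refl

  rhsCoefficient-recurrence-step : ∀ (N1 RN R σ σ′ σ″ A1 A0 A′ T3a B1 B0 B′ T3b T3 : ℚ) → σ′ ≡ - σ → T3 ≡ ½ * (T3a + σ′ * T3b)
    → R * σ″ ≡ R * σ → N1 * A1 ≡ RN * A0 + R * A′ + T3a → N1 * B1 ≡ - (RN * B0) + R * B′ - T3b
    → N1 * (½ * (A1 + σ * B1)) ≡ RN * (½ * (A0 + σ′ * B0)) + R * (½ * (A′ + σ″ * B′)) + T3
  rhsCoefficient-recurrence-step N1 RN R σ _ σ″ A1 A0 A′ T3a B1 B0 B′ T3b _ refl refl hS hA hB =
    linear-combination₃ hS hA hB (- ½ * B′) ½ (½ * σ)
      (ring-solve (N1 ∷ RN ∷ R ∷ σ ∷ σ″ ∷ A1 ∷ A0 ∷ A′ ∷ T3a ∷ B1 ∷ B0 ∷ B′ ∷ T3b ∷ []) ℚ-ring)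

  rhsCoefficient-recurrence : ∀ i r n → fromℕ (suc n) * rhsCoefficient i r (suc n)
    ≡ fromℕ (r ℕ.+ n) * rhsCoefficient (toggle i) r n + fromℕ r * rhsCoefficient (toggle i) (pred r) n
      + shift (rhsCoefficient (toggle i) r) n
  rhsCoefficient-recurrence i r n = rhsCoefficient-recurrence-step (fromℕ (suc n)) (fromℕ (r ℕ.+ n)) (fromℕ r)
    (sgn (r ℕ.+ toℕ i)) (sgn (r ℕ.+ toℕ (toggle i))) (sgn (pred r ℕ.+ toℕ (toggle i)))
    (total r (suc n)) (total r n) (total (pred r) n) (shift (total r) n)
    (signed r (suc n)) (signed r n) (signed (pred r) n) (shift (signed r) n) (shift (rhsCoefficient (toggle i) r) n)
    (sgn-toggle r i) (shift-rhsCoefficient i r n) (sgn-pred r i) (total-recurrence r n) (signed-recurrence r n)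

  EGFCoefficient : ℕ → Set
  EGFCoefficient n = ∀ r i → fromℕ (separatedDerangements r n i) ≡ fromℕ (n !) * rhsCoefficient i r n

  egfCoefficient-zero : EGFCoefficient 0
  egfCoefficient-zero zero zero rewrite total-constant 0 | signed-constant 0 = refl
  egfCoefficient-zero zero (suc zero) rewrite total-constant 0 | signed-constant 0 = refl
  egfCoefficient-zero (suc t) zero rewrite total-constant (suc t) | signed-constant (suc t) =
    solve 1 (λ s → con 0ℚ := con 1ℚ :* (con ½ :* (con 0ℚ :+ s :* con 0ℚ))) refl (sgn (suc t ℕ.+ 0))
  egfCoefficient-zero (suc t) (suc zero) rewrite total-constant (suc t) | signed-constant (suc t) =
    solve 1 (λ s → con 0ℚ := con 1ℚ :* (con ½ :* (con 0ℚ :+ s :* con 0ℚ))) refl (sgn (suc t ℕ.+ 1))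

  egfCoefficient-shift : ∀ i r n → EGFCoefficient (pred n)
    → fromℕ n * fromℕ (separatedDerangements r (pred n) i) ≡ fromℕ (n !) * shift (rhsCoefficient i r) n
  egfCoefficient-shift i r zero _ = trans (ℚ.*-zeroˡ (fromℕ (separatedDerangements r 0 i))) (sym (ℚ.*-zeroʳ (fromℕ 1)))
  egfCoefficient-shift i r (suc k) egf-k = begin
    fromℕ (suc k) * fromℕ (separatedDerangements r k i)  ≡⟨ cong (fromℕ (suc k) *_) (egf-k r i) ⟩
    fromℕ (suc k) * (fromℕ (k !) * rhsCoefficient i r k) ≡⟨ ℚ.*-assoc (fromℕ (suc k)) (fromℕ (k !)) _ ⟨
    fromℕ (suc k) * fromℕ (k !) * rhsCoefficient i r k   ≡⟨ cong (_* rhsCoefficient i r k) (fromℕ-* (suc k) (k !)) ⟨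
    fromℕ (suc k !) * rhsCoefficient i r k               ∎
    where open ≡-Reasoning

  egfCoefficient-suc : ∀ n → EGFCoefficient n → EGFCoefficient (pred n) → EGFCoefficient (suc n)
  egfCoefficient-suc n egf-n egf-pred r i = begin
    fromℕ (d r (suc n) i)
      ≡⟨ cong fromℕ (separatedDerangements-suc r n i) ⟩
    fromℕ ((r ℕ.+ n) ℕ.* d r n i′ ℕ.+ r ℕ.* d (pred r) n i′ ℕ.+ n ℕ.* d r (pred n) i′)
      ≡⟨ cast-sum (r ℕ.+ n) (d r n i′) r (d (pred r) n i′) n (d r (pred n) i′) ⟩
    fromℕ (r ℕ.+ n) * fromℕ (d r n i′) + fromℕ r * fromℕ (d (pred r) n i′) + fromℕ n * fromℕ (d r (pred n) i′)
      ≡⟨ cong₂ _+_ (cong₂ (λ a b → fromℕ (r ℕ.+ n) * a + fromℕ r * b) (egf-n r i′) (egf-n (pred r) i′))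
                   (egfCoefficient-shift i′ r n egf-pred) ⟩
    fromℕ (r ℕ.+ n) * (N * c i′ r n) + fromℕ r * (N * c i′ (pred r) n) + N * shift (c i′ r) n
      ≡⟨ solve 6 (λ a b N x y z → a :* (N :* x) :+ b :* (N :* y) :+ N :* z := N :* (a :* x :+ b :* y :+ z)) refl
           (fromℕ (r ℕ.+ n)) (fromℕ r) N (c i′ r n) (c i′ (pred r) n) (shift (c i′ r) n) ⟩
    N * (fromℕ (r ℕ.+ n) * c i′ r n + fromℕ r * c i′ (pred r) n + shift (c i′ r) n)
      ≡⟨ cong (N *_) (rhsCoefficient-recurrence i r n) ⟨
    N * (fromℕ (suc n) * c i r (suc n))
      ≡⟨ solve 3 (λ N a x → N :* (a :* x) := (a :* N) :* x) refl N (fromℕ (suc n)) (c i r (suc n)) ⟩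
    fromℕ (suc n) * N * c i r (suc n)
      ≡⟨ cong (_* c i r (suc n)) (fromℕ-* (suc n) (n !)) ⟨
    fromℕ (suc n !) * c i r (suc n) ∎
    where
    open ≡-Reasoning
    d = separatedDerangements
    c = rhsCoefficient
    i′ = toggle i
    N = fromℕ (n !)
    cast-sum : ∀ a x b y e z → fromℕ (a ℕ.* x ℕ.+ b ℕ.* y ℕ.+ e ℕ.* z)
      ≡ fromℕ a * fromℕ x + fromℕ b * fromℕ y + fromℕ e * fromℕ z
    cast-sum a x b y e z = trans (fromℕ-+ (a ℕ.* x ℕ.+ b ℕ.* y) (e ℕ.* z))
      (cong₂ _+_ (trans (fromℕ-+ (a ℕ.* x) (b ℕ.* y)) (cong₂ _+_ (fromℕ-* a x) (fromℕ-* b y))) (fromℕ-* e z))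

  egfCoefficient-pair : ∀ n → EGFCoefficient n × EGFCoefficient (suc n)
  egfCoefficient-pair zero = egfCoefficient-zero , egfCoefficient-suc 0 egfCoefficient-zero egfCoefficient-zero
  egfCoefficient-pair (suc n) = let egf-n , egf-suc = egfCoefficient-pair n in egf-suc , egfCoefficient-suc (suc n) egf-suc egf-n

  separatedDerangements-egf : ∀ r i n → ((ℤ.+ separatedDerangements r n i) / (n !)) {{n !≢0}} ≡ rhs i r n
  separatedDerangements-egf r i n = begin
    ((ℤ.+ separatedDerangements r n i) / (n !)) {{n !≢0}}  ≡⟨ fromℕ/ (separatedDerangements r n i) (n !) {{n !≢0}} ⟩
    fromℕ (separatedDerangements r n i) * invFactorial n    ≡⟨ cong (_* invFactorial n) (proj₁ (egfCoefficient-pair n) r i) ⟩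
    (fromℕ (n !) * rhsCoefficient i r n) * invFactorial n
      ≡⟨ solve 3 (λ N x j → (N :* x) :* j := x :* (j :* N)) refl (fromℕ (n !)) (rhsCoefficient i r n) (invFactorial n) ⟩
    rhsCoefficient i r n * (invFactorial n * fromℕ (n !))   ≡⟨ cong (rhsCoefficient i r n *_) (invFactorial-inverse n) ⟩
    rhsCoefficient i r n * 1ℚ                               ≡⟨ ℚ.*-identityʳ _ ⟩
    rhsCoefficient i r n                                    ≡⟨ rhs≡rhsCoefficient i r n ⟨
    rhs i r n                                               ∎
    where open ≡-Reasoning

open Counting using (separatedDerangements; D≡separatedDerangements)
open Coefficients using (separatedDerangements-egf)

theorem7p6 : (r : ℕ) (i : Fin 2) → egfD i r ≋ rhs i r
theorem7p6 r i n = begin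
  egfD i r n                                            ≡⟨ cong (λ d → ((ℤ.+ d) ℚ./ (n !)) {{n !≢0}}) (D≡separatedDerangements i r n) ⟩
  ((ℤ.+ separatedDerangements r n i) ℚ./ (n !)) {{n !≢0}} ≡⟨ separatedDerangements-egf r i n ⟩
  rhs i r n                                             ∎
  where open ≡-Reasoning
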